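{- For a positive integer $n$, let $H(n)$ be the number, up to isomorphism, of complete simple games on $n$ voters having exactly two classes of equally desirable voters, and for non-negative integers $a,b$ let $G(a,b)$ be the number of matrices with non-negative integer entries and an arbitrary number $r\ge1$ of rows, $(m_{i,1}\ m_{i,2})_{1\le i\le r}$, such that $0\le m_{i,1}\le a$, $0\le m_{i,2}\le b$ for all $i$, and: if $r=1$ then $m_{1,1}>0$ and $m_{1,2}<b$; if $r\ge2$ then $m_{i,1}>m_{j,1}$ and $m_{i,1}+m_{i,2}<m_{j,1}+m_{j,2}$ for all $1\le i<j\le r$. Then $$H(n)=\sum_{a=1}^{n}G(a,n-a),$$ and furthermore $H(n)=F(n+6)-(n^2+4n+8)$, where $F(m)$ is the $m$-th Fibonacci number.
   Context: A simple game is a pair $(N,W)$ with $N=\{1,\dots,n\}$ and $W$ a family of subsets of $N$ with $N\in W$, $\emptyset\notin W$, and $W$ closed under supersets. Voter $i$ is more desirable than $j$ if for all $S\subseteq N\setminus\{i,j\}$, $S\cup\{j\}\in W\Rightarrow S\cup\{i\}\in W$; $i,j$ are equally desirable if $S\cup\{i\}\in W\iff S\cup\{j\}\in W$ for all such $S$. The game is complete if the desirability relation is a complete preorder; "two classes" means the equivalence classes under equal desirability are exactly two nonempty sets $N_1,N_2$, with voters of $N_1$ strictly more desirable than those of $N_2$. Games $(N,W)$, $(N',W')$ are isomorphic if a bijection $f:N\to N'$ satisfies $S\in W\iff f(S)\in W'$. Fibonacci numbers: $F(0)=0$, $F(1)=1$, $F(m)=F(m-1)+F(m-2)$. -}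

module Defs where

open import Data.Nat using (ℕ; zero; suc; _+_; _≤_; _<_)
open import Data.Bool using (Bool; true; false)
open import Data.Fin using (Fin)
open import Data.Fin.Subset using (Subset; _∈_; _∉_; _⊆_; _∪_; ⁅_⁆; ⊤; ⊥; Nonempty)
open import Data.Vec using (lookup; tabulate)
open import Data.Product using (Σ; Σ-syntax; _×_; proj₁; proj₂)
open import Data.Sum using (_⊎_)
open import Data.List using (List; length)
open import Data.List.Relation.Unary.All using (All)
open import Data.List.Relation.Unary.Any using (Any)
open import Data.List.Relation.Unary.AllPairs using (AllPairs)
open import Data.List.Relation.Unary.Unique.Propositional using (Unique)
open import Data.List.Membership.Propositional using () renaming (_∈_ to _∈ₗ_)
open import Relation.Binary.PropositionalEquality using (_≡_)
open import Relation.Nullary using (¬_)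
open import Function.Bundles using (_↔_; Inverse)

F : ℕ → ℕ
F zero = 0
F (suc zero) = 1
F (suc (suc m)) = F (suc m) + F m

sum1to : (ℕ → ℕ) → ℕ → ℕ
sum1to g zero = 0
sum1to g (suc n) = sum1to g n + g (suc n)

Family : ℕ → Set
Family n = Subset n → Bool

Win : ∀ {n} → Family n → Subset n → Set
Win W S = W S ≡ true

IsSimpleGame : ∀ {n} → Family n → Set
IsSimpleGame W =
  Win W ⊤ × ¬ Win W ⊥ × (∀ S T → S ⊆ T → Win W S → Win W T)

MoreDesirable : ∀ {n} → Family n → Fin n → Fin n → Set
MoreDesirable W i j =
  ∀ S → i ∉ S → j ∉ S → Win W (S ∪ ⁅ j ⁆) → Win W (S ∪ ⁅ i ⁆)

EquallyDesirable : ∀ {n} → Family n → Fin n → Fin n → Set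
EquallyDesirable W i j =
  ∀ S → i ∉ S → j ∉ S → (Win W (S ∪ ⁅ i ⁆) → Win W (S ∪ ⁅ j ⁆))
                       × (Win W (S ∪ ⁅ j ⁆) → Win W (S ∪ ⁅ i ⁆))

IsComplete : ∀ {n} → Family n → Set
IsComplete W =
  (∀ i → MoreDesirable W i i)
  × (∀ i j k → MoreDesirable W i j → MoreDesirable W j k → MoreDesirable W i k)
  × (∀ i j → MoreDesirable W i j ⊎ MoreDesirable W j i)

HasTwoClasses : ∀ {n} → Family n → Set
HasTwoClasses {n} W = Σ[ N₁ ∈ Subset n ] Σ[ N₂ ∈ Subset n ]
    Nonempty N₁ × Nonempty N₂
  × (∀ i → (i ∈ N₁ × i ∉ N₂) ⊎ (i ∉ N₁ × i ∈ N₂))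
  × (∀ i j → i ∈ N₁ → j ∈ N₁ → EquallyDesirable W i j)
  × (∀ i j → i ∈ N₂ → j ∈ N₂ → EquallyDesirable W i j)
  × (∀ i j → i ∈ N₁ → j ∈ N₂ → MoreDesirable W i j × ¬ MoreDesirable W j i)

CompleteTwoClassGame : ∀ {n} → Family n → Set
CompleteTwoClassGame W = IsSimpleGame W × IsComplete W × HasTwoClasses W

image : ∀ {n} → (Fin n ↔ Fin n) → Subset n → Subset n
image f S = tabulate (λ j → lookup S (Inverse.from f j))

Isomorphic : ∀ {n} → Family n → Family n → Set
Isomorphic {n} W W′ =
  Σ[ f ∈ (Fin n ↔ Fin n) ] (∀ S → (Win W S → Win W′ (image f S))
                                × (Win W′ (image f S) → Win W S))

NumTwoClassGamesUpToIso : ℕ → ℕ → Set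
NumTwoClassGamesUpToIso n h = Σ[ reps ∈ List (Family n) ]
    length reps ≡ h
  × All CompleteTwoClassGame reps
  × AllPairs (λ W W′ → ¬ Isomorphic W W′) reps
  × (∀ W → CompleteTwoClassGame W → Any (Isomorphic W) reps)

-- The matrices counted by G(a,b): a matrix with r rows and 2 columns is the
-- list of its rows (m_{i,1}, m_{i,2}), in order.

Matrix2 : Set
Matrix2 = List (ℕ × ℕ)

ValidMatrix : ℕ → ℕ → Matrix2 → Set
ValidMatrix a b M =
    1 ≤ length M
  × All (λ p → proj₁ p ≤ a × proj₂ p ≤ b) M
  × (length M ≡ 1 → All (λ p → 0 < proj₁ p × proj₂ p < b) M)
  × (2 ≤ length M →
       AllPairs (λ p q → proj₁ q < proj₁ p × proj₁ p + proj₂ p < proj₁ q + proj₂ q) M)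

NumMatrices : ℕ → ℕ → ℕ → Set
NumMatrices a b k = Σ[ Ms ∈ List Matrix2 ]
    length Ms ≡ k
  × Unique Ms
  × All (ValidMatrix a b) Ms
  × (∀ M → ValidMatrix a b M → M ∈ₗ Ms)

-- Equally desirable voters can be swapped, so a complete game with classes N₁ ≻ N₂ decides a
-- coalition by its profile (x , y), the numbers of its members in N₁ and in N₂. The winning
-- profiles are monotone and survive trading a member of N₂ for one of N₁, hence are exactly
-- the profiles dominating one of the minimal winning ones; listed by decreasing first entry
-- these form a matrix as in the statement, a single row being excluded when it would make
-- the two classes equally desirable. Conversely every such matrix defines such a game, and
-- isomorphic games have equal matrices since isomorphisms preserve the top class.
-- Counting the matrices by their first row, the number A(a , b) of all chains in the box
-- (including the empty and the one-row ones) satisfies A(a+1 , b+1) = A(a+1 , b) + A(a , b)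
-- with A(a , 0) = a + 2 and A(0 , b) = b + 2, and G(a , b) = A(a , b) − (a + b + 2). The sums
-- D(n) of A along the anti-diagonals obey D(n+2) = D(n+1) + D(n) + 2n + 6, whence the formula.

module Submission where

open import Defs
open import Data.Bool using (Bool; true; false; not; _∧_; _∨_; if_then_else_)
open import Data.Bool.Properties using (not-¬; not-injective; ⇔→≡)
open import Data.Fin using (Fin; zero; suc; fromℕ; inject₁; punchIn)
open import Data.Fin.Subset using (Subset; ⊤; ⊥; ⁅_⁆; _∪_; ∁; _∈_; _∉_; _⊆_)
open import Data.Fin.Subset.Properties using (⊆⊤; drop-∷-⊆; x∈⁅x⁆; x∈⁅y⁆⇒x≡y; ∪-identityʳ)
open import Data.Nat using (ℕ; zero; suc; _+_; _*_; _∸_; _≤_; _<_; z≤n; s≤s; _≤?_; _<?_)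
open import Data.Nat.Properties
open import Data.Nat.Tactic.RingSolver using (solve-∀)
open import Algebra.Properties.CommutativeMonoid.Sum +-0-commutativeMonoid using (sum-permute; sum-cong-≗) renaming (sum to ∑)
open import Data.Product using (Σ-syntax; _×_; _,_; proj₁; proj₂; map₁; map₂; uncurry)
open import Data.Product.Properties using (,-injectiveˡ; ,-injectiveʳ)
open import Data.Sum using (_⊎_; inj₁; inj₂)
open import Data.Vec using ([]; _∷_; here; there; lookup)
open import Data.Maybe using (Maybe; just; nothing; _<∣>_)
open import Data.List using (List; []; _∷_; _++_; length; map; concatMap)
open import Data.Nat.ListAction using (sum)
open import Data.List.Properties using (length-++; length-map; ∷-injectiveˡ; ∷-injectiveʳ; ++-identityʳ)
open import Data.List.Relation.Unary.All using (All; []; _∷_)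
import Data.List.Relation.Unary.All as All
import Data.List.Relation.Unary.All.Properties as All
open import Data.List.Relation.Unary.Any using (Any; any?) renaming (here to hereₗ; there to thereₗ)
import Data.List.Relation.Unary.Any as Any
open import Data.List.Relation.Unary.AllPairs using (AllPairs; []; _∷_)
import Data.List.Relation.Unary.AllPairs as AllPairs
import Data.List.Relation.Unary.AllPairs.Properties as AllPairs
open import Data.List.Membership.Propositional using (find; lose) renaming (_∈_ to _∈ₗ_)
open import Data.List.Membership.Propositional.Properties
  using (∈-++⁺ˡ; ∈-++⁺ʳ; ∈-++⁻; ∈-map⁺; ∈-map⁻; ∈-concatMap⁺; ∈-concatMap⁻)
open import Data.List.Relation.Unary.Unique.Propositional using (Unique)
import Data.List.Relation.Unary.Unique.Propositional.Properties as Unique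
open import Data.Vec.Properties using ([]=⇒lookup; lookup⇒[]=; lookup-replicate; lookup-map; lookup-zipWith; lookup∘tabulate)
open import Data.Fin.Permutation using (Permutation′; _⟨$⟩ʳ_; _⟨$⟩ˡ_; inverseˡ; inverseʳ; flip; lift₀; insert; insert-punchIn)
import Data.Fin.Permutation as Permutation
open import Function using (_∘_)
open import Function.Bundles using (mk⇔)
open import Relation.Nullary using (¬_; contradiction; Dec; yes; no; does; _×-dec_)
open import Relation.Nullary.Decidable using (dec-true; dec-false)
open import Relation.Binary using (Decidable; Asymmetric)
open import Relation.Binary.PropositionalEquality

private
  variable
    n x y : ℕ
    i j : Fin n
    C : Subset n

lookup-ext : {S T : Subset n} → (∀ i → lookup S i ≡ lookup T i) → S ≡ T
lookup-ext {S = []}    {[]}    _  = refl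
lookup-ext {S = s ∷ S} {t ∷ T} eq = cong₂ _∷_ (eq zero) (lookup-ext (eq ∘ suc))

lookup≡false⇒∉ : {S : Subset n} → lookup S i ≡ false → i ∉ S
lookup≡false⇒∉ eq i∈S = not-¬ eq ([]=⇒lookup i∈S)

∉⇒lookup≡false : {S : Subset n} → i ∉ S → lookup S i ≡ false
∉⇒lookup≡false {i = i} {S} i∉S with lookup S i in eq
... | true  = contradiction (lookup⇒[]= i S eq) i∉S
... | false = refl

lookup-⊤ : (i : Fin n) → lookup ⊤ i ≡ true
lookup-⊤ i = lookup-replicate i true

lookup-∁ : (C : Subset n) (i : Fin n) → lookup (∁ C) i ≡ not (lookup C i)
lookup-∁ C i = lookup-map i not C

∈∁⇒lookup≡false : i ∈ ∁ C → lookup C i ≡ false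
∈∁⇒lookup≡false {i = i} {C} i∈∁C = not-injective (trans (sym (lookup-∁ C i)) ([]=⇒lookup i∈∁C))

lookup-∪ : (S T : Subset n) (i : Fin n) → lookup (S ∪ T) i ≡ lookup S i ∨ lookup T i
lookup-∪ S T i = lookup-zipWith _∨_ i S T

lookup-⁅⁆ : (i j : Fin n) → lookup ⁅ i ⁆ j ≡ true → i ≡ j
lookup-⁅⁆ i j eq = sym (x∈⁅y⁆⇒x≡y i (lookup⇒[]= j ⁅ i ⁆ eq))

lookup-⁅⁆-self : (i : Fin n) → lookup ⁅ i ⁆ i ≡ true
lookup-⁅⁆-self i = []=⇒lookup (x∈⁅x⁆ i)

remove : Subset n → Fin n → Subset n
remove (_ ∷ S) zero    = false ∷ S
remove (s ∷ S) (suc i) = s ∷ remove S i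

lookup-remove-self : (S : Subset n) (i : Fin n) → lookup (remove S i) i ≡ false
lookup-remove-self (_ ∷ S) zero    = refl
lookup-remove-self (_ ∷ S) (suc i) = lookup-remove-self S i

lookup-remove-other : (S : Subset n) → i ≢ j → lookup (remove S i) j ≡ lookup S j
lookup-remove-other {i = zero}  {zero}  (_ ∷ S) i≢j = contradiction refl i≢j
lookup-remove-other {i = zero}  {suc j} (_ ∷ S) _   = refl
lookup-remove-other {i = suc i} {zero}  (_ ∷ S) _   = refl
lookup-remove-other {i = suc i} {suc j} (_ ∷ S) i≢j = lookup-remove-other S (i≢j ∘ cong suc)

remove-⊆ : (S : Subset n) (i : Fin n) → remove S i ⊆ S
remove-⊆ (_ ∷ S) zero    (there j∈S) = there j∈S
remove-⊆ (_ ∷ S) (suc i) here        = here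
remove-⊆ (_ ∷ S) (suc i) (there j∈S) = there (remove-⊆ S i j∈S)

remove-∪⁅⁆ : (S : Subset n) (i : Fin n) → lookup S i ≡ true → remove S i ∪ ⁅ i ⁆ ≡ S
remove-∪⁅⁆ (true ∷ S)  zero    _  = cong (true ∷_) (∪-identityʳ S)
remove-∪⁅⁆ (true ∷ S)  (suc i) eq = cong (true ∷_) (remove-∪⁅⁆ S i eq)
remove-∪⁅⁆ (false ∷ S) (suc i) eq = cong (false ∷_) (remove-∪⁅⁆ S i eq)

count : Subset n → Subset n → ℕ
count []          []          = 0
count (true ∷ P)  (true ∷ S)  = suc (count P S)
count (true ∷ P)  (false ∷ S) = count P S
count (false ∷ P) (_ ∷ S)     = count P S

count-⊥ : (P : Subset n) → count P ⊥ ≡ 0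
count-⊥ []          = refl
count-⊥ (true ∷ P)  = count-⊥ P
count-⊥ (false ∷ P) = count-⊥ P

count-mono : (P : Subset n) {S T : Subset n} → S ⊆ T → count P S ≤ count P T
count-mono []          {[]}        {[]}        _   = z≤n
count-mono (true ∷ P)  {true ∷ S}  {true ∷ T}  S⊆T = s≤s (count-mono P (drop-∷-⊆ S⊆T))
count-mono (true ∷ P)  {true ∷ S}  {false ∷ T} S⊆T with () ← S⊆T here
count-mono (true ∷ P)  {false ∷ S} {true ∷ T}  S⊆T = m≤n⇒m≤1+n (count-mono P (drop-∷-⊆ S⊆T))
count-mono (true ∷ P)  {false ∷ S} {false ∷ T} S⊆T = count-mono P (drop-∷-⊆ S⊆T)
count-mono (false ∷ P) {_ ∷ S}     {_ ∷ T}     S⊆T = count-mono P (drop-∷-⊆ S⊆T)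

count≤count-⊤ : (P S : Subset n) → count P S ≤ count P ⊤
count≤count-⊤ P S = count-mono P ⊆⊤

count>0⇒common : (P S : Subset n) → 0 < count P S → Σ[ i ∈ Fin n ] lookup P i ≡ true × lookup S i ≡ true
count>0⇒common []          []          ()
count>0⇒common (true ∷ P)  (true ∷ S)  _  = zero , refl , refl
count>0⇒common (true ∷ P)  (false ∷ S) 0< = let i , i∈P , i∈S = count>0⇒common P S 0< in suc i , i∈P , i∈S
count>0⇒common (false ∷ P) (_ ∷ S)     0< = let i , i∈P , i∈S = count>0⇒common P S 0< in suc i , i∈P , i∈S

count-∪⁅⁆-∈ : (P S : Subset n) (i : Fin n) → lookup S i ≡ false → lookup P i ≡ true →
              count P (S ∪ ⁅ i ⁆) ≡ suc (count P S)
count-∪⁅⁆-∈ (true ∷ P)  (false ∷ S) zero    _ _ = cong suc (cong (count P) (∪-identityʳ S))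
count-∪⁅⁆-∈ (true ∷ P)  (true ∷ S)  (suc i) i∉S i∈P = cong suc (count-∪⁅⁆-∈ P S i i∉S i∈P)
count-∪⁅⁆-∈ (true ∷ P)  (false ∷ S) (suc i) i∉S i∈P = count-∪⁅⁆-∈ P S i i∉S i∈P
count-∪⁅⁆-∈ (false ∷ P) (_ ∷ S)     (suc i) i∉S i∈P = count-∪⁅⁆-∈ P S i i∉S i∈P

count-∪⁅⁆-∉ : (P S : Subset n) (i : Fin n) → lookup S i ≡ false → lookup P i ≡ false →
              count P (S ∪ ⁅ i ⁆) ≡ count P S
count-∪⁅⁆-∉ (false ∷ P) (false ∷ S) zero    _ _ = cong (count P) (∪-identityʳ S)
count-∪⁅⁆-∉ (true ∷ P)  (true ∷ S)  (suc i) i∉S i∉P = cong suc (count-∪⁅⁆-∉ P S i i∉S i∉P)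
count-∪⁅⁆-∉ (true ∷ P)  (false ∷ S) (suc i) i∉S i∉P = count-∪⁅⁆-∉ P S i i∉S i∉P
count-∪⁅⁆-∉ (false ∷ P) (_ ∷ S)     (suc i) i∉S i∉P = count-∪⁅⁆-∉ P S i i∉S i∉P

profile : Subset n → Subset n → ℕ × ℕ
profile C S = count C S , count (∁ C) S

bump : Bool → ℕ × ℕ → ℕ × ℕ
bump true  = map₁ suc
bump false = map₂ suc

bump-injective : ∀ c {p q : ℕ × ℕ} → bump c p ≡ bump c q → p ≡ q
bump-injective true  {_ , _} {_ , _} eq = cong₂ _,_ (suc-injective (,-injectiveˡ eq)) (,-injectiveʳ eq)
bump-injective false {_ , _} {_ , _} eq = cong₂ _,_ (,-injectiveˡ eq) (suc-injective (,-injectiveʳ eq))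

profile-∷-true : ∀ c (C S : Subset n) → profile (c ∷ C) (true ∷ S) ≡ bump c (profile C S)
profile-∷-true true  C S = refl
profile-∷-true false C S = refl

profile-∷-false : ∀ c (C S : Subset n) → profile (c ∷ C) (false ∷ S) ≡ profile C S
profile-∷-false true  C S = refl
profile-∷-false false C S = refl

profile-⊥ : (C : Subset n) → profile C ⊥ ≡ (0 , 0)
profile-⊥ C = cong₂ _,_ (count-⊥ C) (count-⊥ (∁ C))

profile-∪⁅⁆ : (C S : Subset n) (i : Fin n) → lookup S i ≡ false →
              profile C (S ∪ ⁅ i ⁆) ≡ bump (lookup C i) (profile C S)
profile-∪⁅⁆ C S i i∉S with lookup C i in i∈C
... | true  = cong₂ _,_ (count-∪⁅⁆-∈ C S i i∉S i∈C)
                        (count-∪⁅⁆-∉ (∁ C) S i i∉S (trans (lookup-∁ C i) (cong not i∈C)))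
... | false = cong₂ _,_ (count-∪⁅⁆-∉ C S i i∉S i∈C)
                        (count-∪⁅⁆-∈ (∁ C) S i i∉S (trans (lookup-∁ C i) (cong not i∈C)))

profile-remove : (C S : Subset n) (i : Fin n) → lookup S i ≡ true →
                 profile C S ≡ bump (lookup C i) (profile C (remove S i))
profile-remove C S i i∈S = begin
  profile C S                                      ≡⟨ cong (profile C) (remove-∪⁅⁆ S i i∈S) ⟨
  profile C (remove S i ∪ ⁅ i ⁆)                   ≡⟨ profile-∪⁅⁆ C (remove S i) i (lookup-remove-self S i) ⟩
  bump (lookup C i) (profile C (remove S i))       ∎
  where open ≡-Reasoning

bump-profile⇒member : ∀ c {p} (C S : Subset n) → bump c p ≡ profile C S →
                      Σ[ j ∈ Fin n ] lookup C j ≡ c × lookup S j ≡ true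
bump-profile⇒member true  C S eq = count>0⇒common C S (subst (0 <_) (,-injectiveˡ eq) (s≤s z≤n))
bump-profile⇒member false C S eq with count>0⇒common (∁ C) S (subst (0 <_) (,-injectiveʳ eq) (s≤s z≤n))
... | j , j∉C , j∈S = j , not-injective (trans (sym (lookup-∁ C j)) j∉C) , j∈S

SwapInvariant : Subset n → (Subset n → Bool) → Set
SwapInvariant {n} C W = ∀ (R : Subset n) i j → lookup C i ≡ lookup C j →
  lookup R i ≡ false → lookup R j ≡ false → W (R ∪ ⁅ i ⁆) ≡ W (R ∪ ⁅ j ⁆)

swapInvariant-tail : ∀ {c} {W : Subset (suc n) → Bool} → SwapInvariant (c ∷ C) W →
                     ∀ t → SwapInvariant C (λ T → W (t ∷ T))
swapInvariant-tail h true  R i j = h (true ∷ R) (suc i) (suc j)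
swapInvariant-tail h false R i j = h (false ∷ R) (suc i) (suc j)

-- A swap-invariant family only depends on profiles: bring a member of S′ of the
-- right side to the front by one swap, then recurse on the tails.
mutual
  profile-determines : (C : Subset n) (W : Subset n → Bool) → SwapInvariant C W →
                       ∀ S S′ → profile C S ≡ profile C S′ → W S ≡ W S′
  profile-determines []      W h []        []         eq = refl
  profile-determines (c ∷ C) W h (true ∷ S)  (true ∷ S′) eq =
    profile-determines C _ (swapInvariant-tail {W = W} h true) S S′
      (bump-injective c (trans (sym (profile-∷-true c C S)) (trans eq (profile-∷-true c C S′))))
  profile-determines (c ∷ C) W h (false ∷ S) (false ∷ S′) eq =
    profile-determines C _ (swapInvariant-tail {W = W} h false) S S′
      (trans (sym (profile-∷-false c C S)) (trans eq (profile-∷-false c C S′)))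
  profile-determines (c ∷ C) W h (true ∷ S)  (false ∷ S′) eq =
    move-to-front c C W h S S′ (trans (sym (profile-∷-true c C S)) (trans eq (profile-∷-false c C S′)))
  profile-determines (c ∷ C) W h (false ∷ S) (true ∷ S′) eq =
    sym (move-to-front c C W h S′ S (trans (sym (profile-∷-true c C S′)) (trans (sym eq) (profile-∷-false c C S))))

  move-to-front : ∀ c (C : Subset n) (W : Subset (suc n) → Bool) → SwapInvariant (c ∷ C) W →
                  ∀ S S′ → bump c (profile C S) ≡ profile C S′ → W (true ∷ S) ≡ W (false ∷ S′)
  move-to-front c C W h S S′ eq with bump-profile⇒member c C S′ eq
  ... | j , j∈c , j∈S′ = begin
    W (true ∷ S)                 ≡⟨ profile-determines C _ (swapInvariant-tail {W = W} h true) S R R-profile ⟩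
    W (true ∷ R)                 ≡⟨ cong (λ X → W (true ∷ X)) (∪-identityʳ R) ⟨
    W ((false ∷ R) ∪ ⁅ zero ⁆)   ≡⟨ h (false ∷ R) zero (suc j) (sym j∈c) refl (lookup-remove-self S′ j) ⟩
    W (false ∷ (R ∪ ⁅ j ⁆))      ≡⟨ cong (λ X → W (false ∷ X)) (remove-∪⁅⁆ S′ j j∈S′) ⟩
    W (false ∷ S′)               ∎
    where
    open ≡-Reasoning
    R = remove S′ j
    R-profile : profile C S ≡ profile C R
    R-profile = bump-injective c (trans eq (trans (profile-remove C S′ j j∈S′) (cong (λ d → bump d (profile C R)) j∈c)))

pick : Subset n → Subset n → ℕ → ℕ → Subset n
pick []          []          x       y       = []
pick (c ∷ C)     (false ∷ A) x       y       = false ∷ pick C A x y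
pick (true ∷ C)  (true ∷ A)  zero    y       = false ∷ pick C A zero y
pick (true ∷ C)  (true ∷ A)  (suc x) y       = true ∷ pick C A x y
pick (false ∷ C) (true ∷ A)  x       zero    = false ∷ pick C A x zero
pick (false ∷ C) (true ∷ A)  x       (suc y) = true ∷ pick C A x y

pick-profile : (C A : Subset n) → x ≤ count C A → y ≤ count (∁ C) A → profile C (pick C A x y) ≡ (x , y)
pick-profile []          []          z≤n      z≤n      = refl
pick-profile (true ∷ C)  (false ∷ A) x≤       y≤       = pick-profile C A x≤ y≤
pick-profile (false ∷ C) (false ∷ A) x≤       y≤       = pick-profile C A x≤ y≤
pick-profile (true ∷ C)  (true ∷ A)  z≤n      y≤       = pick-profile C A z≤n y≤
pick-profile (true ∷ C)  (true ∷ A)  (s≤s x≤) y≤       = cong (map₁ suc) (pick-profile C A x≤ y≤)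
pick-profile (false ∷ C) (true ∷ A)  x≤       z≤n      = pick-profile C A x≤ z≤n
pick-profile (false ∷ C) (true ∷ A)  x≤       (s≤s y≤) = cong (map₂ suc) (pick-profile C A x≤ y≤)

pick-avoids : (C A : Subset n) → lookup A i ≡ false → lookup (pick C A x y) i ≡ false
pick-avoids {i = zero}                (c ∷ C)     (false ∷ A) _   = refl
pick-avoids {i = suc i}               (c ∷ C)     (false ∷ A) i∉A = pick-avoids C A i∉A
pick-avoids {i = suc i} {x = zero}    (true ∷ C)  (true ∷ A)  i∉A = pick-avoids C A i∉A
pick-avoids {i = suc i} {x = suc x}   (true ∷ C)  (true ∷ A)  i∉A = pick-avoids C A i∉A
pick-avoids {i = suc i} {y = zero}    (false ∷ C) (true ∷ A)  i∉A = pick-avoids C A i∉A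
pick-avoids {i = suc i} {y = suc y}   (false ∷ C) (true ∷ A)  i∉A = pick-avoids C A i∉A

realise : (C : Subset n) → x ≤ count C ⊤ → y ≤ count (∁ C) ⊤ → profile C (pick C ⊤ x y) ≡ (x , y)
realise C = pick-profile C ⊤

realise-avoiding : (C : Subset n) → lookup C i ≡ true → lookup C j ≡ false →
                   x < count C ⊤ → y < count (∁ C) ⊤ →
                   Σ[ R ∈ Subset n ] lookup R i ≡ false × lookup R j ≡ false × profile C R ≡ (x , y)
realise-avoiding {i = i} {j} {x} {y} C i∈C j∉C x< y< =
  pick C A x y , pick-avoids C A A∌i , pick-avoids C A (lookup-remove-self A₁ j) ,
  pick-profile C A (≤-pred (subst (x <_) (cong proj₁ ⊤-profile) x<)) (≤-pred (subst (y <_) (cong proj₂ ⊤-profile) y<))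
  where
  i≢j : i ≢ j
  i≢j refl = not-¬ i∈C j∉C
  A₁ = remove ⊤ i
  A  = remove A₁ j
  A∌i : lookup A i ≡ false
  A∌i = trans (lookup-remove-other A₁ (i≢j ∘ sym)) (lookup-remove-self ⊤ i)
  ⊤-profile : profile C ⊤ ≡ (suc (count C A) , suc (count (∁ C) A))
  ⊤-profile = begin
    profile C ⊤                      ≡⟨ profile-remove C ⊤ i (lookup-⊤ i) ⟩
    bump (lookup C i) (profile C A₁) ≡⟨ cong (λ c → bump c (profile C A₁)) i∈C ⟩
    map₁ suc (profile C A₁)          ≡⟨ cong (map₁ suc) (profile-remove C A₁ j (trans (lookup-remove-other ⊤ i≢j) (lookup-⊤ j))) ⟩
    map₁ suc (bump (lookup C j) (profile C A)) ≡⟨ cong (λ c → map₁ suc (bump c (profile C A))) j∉C ⟩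
    (suc (count C A) , suc (count (∁ C) A)) ∎
    where open ≡-Reasoning

module _ (π : Permutation′ n) where

  lookup-image : (S : Subset n) (j : Fin n) → lookup (image π S) j ≡ lookup S (π ⟨$⟩ˡ j)
  lookup-image S j = lookup∘tabulate _ j

  lookup-image-⟨$⟩ʳ : (S : Subset n) (i : Fin n) → lookup (image π S) (π ⟨$⟩ʳ i) ≡ lookup S i
  lookup-image-⟨$⟩ʳ S i = trans (lookup-image S (π ⟨$⟩ʳ i)) (cong (lookup S) (inverseˡ π))

  image-∪⁅⁆ : (S : Subset n) (i : Fin n) → image π (S ∪ ⁅ i ⁆) ≡ image π S ∪ ⁅ π ⟨$⟩ʳ i ⁆
  image-∪⁅⁆ S i = lookup-ext λ j → begin
    lookup (image π (S ∪ ⁅ i ⁆)) j                          ≡⟨ lookup-image (S ∪ ⁅ i ⁆) j ⟩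
    lookup (S ∪ ⁅ i ⁆) (π ⟨$⟩ˡ j)                           ≡⟨ lookup-∪ S ⁅ i ⁆ (π ⟨$⟩ˡ j) ⟩
    (lookup S (π ⟨$⟩ˡ j)) ∨ (lookup ⁅ i ⁆ (π ⟨$⟩ˡ j))        ≡⟨ cong₂ _∨_ (sym (lookup-image S j)) (⁅⁆-moves j) ⟩
    (lookup (image π S) j) ∨ (lookup ⁅ π ⟨$⟩ʳ i ⁆ j)        ≡⟨ lookup-∪ (image π S) ⁅ π ⟨$⟩ʳ i ⁆ j ⟨
    lookup (image π S ∪ ⁅ π ⟨$⟩ʳ i ⁆) j                     ∎
    where
    open ≡-Reasoning
    ⁅⁆-moves : ∀ j → lookup ⁅ i ⁆ (π ⟨$⟩ˡ j) ≡ lookup ⁅ π ⟨$⟩ʳ i ⁆ j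
    ⁅⁆-moves j = ⇔→≡ (mk⇔
      (λ eq → subst (λ k → lookup ⁅ π ⟨$⟩ʳ i ⁆ k ≡ true)
                    (trans (cong (π ⟨$⟩ʳ_) (lookup-⁅⁆ i _ eq)) (inverseʳ π)) (lookup-⁅⁆-self (π ⟨$⟩ʳ i)))
      (λ eq → subst (λ k → lookup ⁅ i ⁆ k ≡ true)
                    (trans (sym (inverseˡ π)) (cong (π ⟨$⟩ˡ_) (lookup-⁅⁆ _ j eq))) (lookup-⁅⁆-self i)))

  image-⊤ : image π ⊤ ≡ ⊤
  image-⊤ = lookup-ext λ j → trans (lookup-image ⊤ j) (trans (lookup-⊤ (π ⟨$⟩ˡ j)) (sym (lookup-⊤ j)))

  image-∁ : (C : Subset n) → image π (∁ C) ≡ ∁ (image π C)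
  image-∁ C = lookup-ext λ j → begin
    lookup (image π (∁ C)) j    ≡⟨ lookup-image (∁ C) j ⟩
    lookup (∁ C) (π ⟨$⟩ˡ j)     ≡⟨ lookup-∁ C _ ⟩
    not (lookup C (π ⟨$⟩ˡ j))   ≡⟨ cong not (lookup-image C j) ⟨
    not (lookup (image π C) j)  ≡⟨ lookup-∁ (image π C) j ⟨
    lookup (∁ (image π C)) j    ∎
    where open ≡-Reasoning

  image-flip : (S : Subset n) → image π (image (flip π) S) ≡ S
  image-flip S = lookup-ext λ j →
    trans (lookup-image (image (flip π) S) j)
          (trans (lookup∘tabulate (λ k → lookup S (π ⟨$⟩ʳ k)) (π ⟨$⟩ˡ j)) (cong (lookup S) (inverseʳ π)))

count-sum : (P S : Subset n) → count P S ≡ ∑ (λ i → if lookup P i ∧ lookup S i then 1 else 0)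
count-sum []          []          = refl
count-sum (true ∷ P)  (true ∷ S)  = cong suc (count-sum P S)
count-sum (true ∷ P)  (false ∷ S) = count-sum P S
count-sum (false ∷ P) (_ ∷ S)     = count-sum P S

count-image : (π : Permutation′ n) (P S : Subset n) → count (image π P) (image π S) ≡ count P S
count-image π P S = begin
  count (image π P) (image π S)
    ≡⟨ count-sum (image π P) (image π S) ⟩
  ∑ (λ j → indicator (lookup (image π P) j) (lookup (image π S) j))
    ≡⟨ sum-cong-≗ (λ j → cong₂ indicator (lookup-image π P j) (lookup-image π S j)) ⟩
  ∑ (λ j → indicator (lookup P (π ⟨$⟩ˡ j)) (lookup S (π ⟨$⟩ˡ j)))
    ≡⟨ sum-permute (λ i → indicator (lookup P i) (lookup S i)) (flip π) ⟨
  ∑ (λ i → indicator (lookup P i) (lookup S i))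
    ≡⟨ count-sum P S ⟨
  count P S
    ∎
  where
  open ≡-Reasoning
  indicator : Bool → Bool → ℕ
  indicator b c = if b ∧ c then 1 else 0

profile-image : (π : Permutation′ n) (C S : Subset n) → profile (image π C) (image π S) ≡ profile C S
profile-image π C S = cong₂ _,_ (count-image π C S)
  (trans (cong (λ D → count D (image π S)) (sym (image-∁ π C))) (count-image π (∁ C) S))

prefix : ℕ → (n : ℕ) → Subset n
prefix a       zero    = []
prefix zero    (suc n) = false ∷ prefix zero n
prefix (suc a) (suc n) = true ∷ prefix a n

profile-prefix : ∀ a n → a ≤ n → profile (prefix a n) ⊤ ≡ (a , n ∸ a)
profile-prefix zero    zero    _       = refl
profile-prefix zero    (suc n) _       = cong (map₂ suc) (profile-prefix zero n z≤n)
profile-prefix (suc a) (suc n) (s≤s a≤n) = cong (map₁ suc) (profile-prefix a n a≤n)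

lookup-prefix-last : ∀ a n → a ≤ n → lookup (prefix a (suc n)) (fromℕ n) ≡ false
lookup-prefix-last zero    zero    _         = refl
lookup-prefix-last zero    (suc n) _         = lookup-prefix-last zero n z≤n
lookup-prefix-last (suc a) (suc n) (s≤s a≤n) = lookup-prefix-last a n a≤n

lookup-prefix-inject₁ : ∀ a n (k : Fin n) → lookup (prefix a (suc n)) (inject₁ k) ≡ lookup (prefix a n) k
lookup-prefix-inject₁ zero    (suc n) zero    = refl
lookup-prefix-inject₁ zero    (suc n) (suc k) = lookup-prefix-inject₁ zero n k
lookup-prefix-inject₁ (suc a) (suc n) zero    = refl
lookup-prefix-inject₁ (suc a) (suc n) (suc k) = lookup-prefix-inject₁ a n k

punchIn-fromℕ : ∀ n (k : Fin n) → punchIn (fromℕ n) k ≡ inject₁ k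
punchIn-fromℕ (suc n) zero    = refl
punchIn-fromℕ (suc n) (suc k) = cong suc (punchIn-fromℕ n k)

count-⊤≤ : (N : Subset n) → count N ⊤ ≤ n
count-⊤≤ []          = z≤n
count-⊤≤ (true ∷ N)  = s≤s (count-⊤≤ N)
count-⊤≤ (false ∷ N) = m≤n⇒m≤1+n (count-⊤≤ N)

count-∁-⊤ : (C : Subset n) → count (∁ C) ⊤ ≡ n ∸ count C ⊤
count-∁-⊤ []          = refl
count-∁-⊤ (true ∷ C)  = count-∁-⊤ C
count-∁-⊤ (false ∷ C) = trans (cong suc (count-∁-⊤ C)) (sym (+-∸-assoc 1 (count-⊤≤ C)))

sortPerm : (N : Subset n) → Permutation′ n
sortPerm []                    = Permutation.id
sortPerm (true ∷ N)            = lift₀ (sortPerm N)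
sortPerm {suc n} (false ∷ N)   = insert zero (fromℕ n) (sortPerm N)

lookup-prefix-sortPerm : (N : Subset n) (i : Fin n) →
                         lookup (prefix (count N ⊤) n) (sortPerm N ⟨$⟩ʳ i) ≡ lookup N i
lookup-prefix-sortPerm (true ∷ N)          zero    = refl
lookup-prefix-sortPerm (true ∷ N)          (suc i) = lookup-prefix-sortPerm N i
lookup-prefix-sortPerm {suc n} (false ∷ N) zero    = lookup-prefix-last (count N ⊤) n (count-⊤≤ N)
lookup-prefix-sortPerm {suc n} (false ∷ N) (suc i) = begin
  lookup (prefix (count N ⊤) (suc n)) (sortPerm (false ∷ N) ⟨$⟩ʳ suc i)
    ≡⟨ cong (lookup (prefix (count N ⊤) (suc n))) (insert-punchIn zero (fromℕ n) (sortPerm N) i) ⟩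
  lookup (prefix (count N ⊤) (suc n)) (punchIn (fromℕ n) (sortPerm N ⟨$⟩ʳ i))
    ≡⟨ cong (lookup (prefix (count N ⊤) (suc n))) (punchIn-fromℕ n _) ⟩
  lookup (prefix (count N ⊤) (suc n)) (inject₁ (sortPerm N ⟨$⟩ʳ i))
    ≡⟨ lookup-prefix-inject₁ (count N ⊤) n _ ⟩
  lookup (prefix (count N ⊤) n) (sortPerm N ⟨$⟩ʳ i)
    ≡⟨ lookup-prefix-sortPerm N i ⟩
  lookup N i ∎
  where open ≡-Reasoning

image-sortPerm : (N : Subset n) → image (sortPerm N) N ≡ prefix (count N ⊤) n
image-sortPerm N = lookup-ext λ j → begin
  lookup (image (sortPerm N) N) j
    ≡⟨ lookup-image (sortPerm N) N j ⟩
  lookup N (sortPerm N ⟨$⟩ˡ j)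
    ≡⟨ lookup-prefix-sortPerm N _ ⟨
  lookup (prefix (count N ⊤) _) (sortPerm N ⟨$⟩ʳ (sortPerm N ⟨$⟩ˡ j))
    ≡⟨ cong (lookup (prefix (count N ⊤) _)) (inverseʳ (sortPerm N)) ⟩
  lookup (prefix (count N ⊤) _) j
    ∎
  where open ≡-Reasoning

Dominant : Family n → Fin n → Set
Dominant {n} W i = ∀ (j : Fin n) → MoreDesirable W i j

module _ {W W′ : Family n} (I : Isomorphic W W′) where
  private
    π = proj₁ I

  moreDesirable-iso : MoreDesirable W i j → MoreDesirable W′ (π ⟨$⟩ʳ i) (π ⟨$⟩ʳ j)
  moreDesirable-iso {i = i} {j} i≽j S′ i∉S′ j∉S′ S′j-wins =
    subst (Win W′) (image-∪ i) (proj₁ (proj₂ I _) (i≽j R (avoid i i∉S′) (avoid j j∉S′)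
      (proj₂ (proj₂ I _) (subst (Win W′) (sym (image-∪ j)) S′j-wins))))
    where
    R = image (flip π) S′
    avoid : ∀ k → π ⟨$⟩ʳ k ∉ S′ → k ∉ R
    avoid k k∉ = lookup≡false⇒∉ (trans (lookup-image (flip π) S′ k) (∉⇒lookup≡false k∉))
    image-∪ : ∀ k → image π (R ∪ ⁅ k ⁆) ≡ S′ ∪ ⁅ π ⟨$⟩ʳ k ⁆
    image-∪ k = trans (image-∪⁅⁆ π R k) (cong (_∪ ⁅ π ⟨$⟩ʳ k ⁆) (image-flip π S′))

  moreDesirable-iso⁻ : MoreDesirable W′ (π ⟨$⟩ʳ i) (π ⟨$⟩ʳ j) → MoreDesirable W i j
  moreDesirable-iso⁻ {i = i} {j} i≽j S i∉S j∉S Sj-wins =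
    proj₂ (proj₂ I _) (subst (Win W′) (sym (image-∪⁅⁆ π S i))
      (i≽j (image π S) (avoid i i∉S) (avoid j j∉S) (subst (Win W′) (image-∪⁅⁆ π S j) (proj₁ (proj₂ I _) Sj-wins))))
    where
    avoid : ∀ k → k ∉ S → π ⟨$⟩ʳ k ∉ image π S
    avoid k k∉ = lookup≡false⇒∉ (trans (lookup-image-⟨$⟩ʳ π S k) (∉⇒lookup≡false k∉))

  dominant-iso : Dominant W i → Dominant W′ (π ⟨$⟩ʳ i)
  dominant-iso {i = i} i-dom j = subst (MoreDesirable W′ (π ⟨$⟩ʳ i)) (inverseʳ π) (moreDesirable-iso (i-dom (π ⟨$⟩ˡ j)))

  dominant-iso⁻ : Dominant W′ (π ⟨$⟩ʳ i) → Dominant W i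
  dominant-iso⁻ i-dom j = moreDesirable-iso⁻ (i-dom (π ⟨$⟩ʳ j))

-- Games in which a coalition wins according to its profile

Table : Set
Table = ℕ → ℕ → Bool

countGame : Subset n → Table → Family n
countGame C t S = uncurry t (profile C S)

countGame-∪⁅⁆ : (C : Subset n) (t : Table) (S : Subset n) (i : Fin n) → lookup S i ≡ false →
                countGame C t (S ∪ ⁅ i ⁆) ≡ uncurry t (bump (lookup C i) (profile C S))
countGame-∪⁅⁆ C t S i i∉S = cong (uncurry t) (profile-∪⁅⁆ C S i i∉S)

-- A trade replaces a voter outside C by one of C; (x₀ , y₀) witnesses a trade
-- that turns a losing coalition into a winning one.
record IsTwoClassTable (C : Subset n) (t : Table) : Set where
  field
    monotone : ∀ {x y x′ y′} → x ≤ x′ → y ≤ y′ → t x y ≡ true → t x′ y′ ≡ true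
    trade    : ∀ x y → t x (suc y) ≡ true → t (suc x) y ≡ true
    top      : uncurry t (profile C ⊤) ≡ true
    bottom   : t 0 0 ≡ false
    x₀ y₀    : ℕ
    x₀<      : x₀ < count C ⊤
    y₀<      : y₀ < count (∁ C) ⊤
    strict   : t (suc x₀) y₀ ≡ true
    strict′  : t x₀ (suc y₀) ≡ false

module TwoClassTable {C : Subset n} {t : Table} (T : IsTwoClassTable C t) where
  open IsTwoClassTable T
  private
    W = countGame C t

  moreDesirable-intro : ∀ i j → (lookup C j ≡ true → lookup C i ≡ true) → MoreDesirable W i j
  moreDesirable-intro i j j∈C⇒i∈C S i∉S j∉S Sj-wins
    rewrite countGame-∪⁅⁆ C t S i (∉⇒lookup≡false i∉S) | countGame-∪⁅⁆ C t S j (∉⇒lookup≡false j∉S)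
    with lookup C i | lookup C j | j∈C⇒i∈C
  ... | true  | true  | _ = Sj-wins
  ... | false | false | _ = Sj-wins
  ... | true  | false | _ = trade _ _ Sj-wins
  ... | false | true  | h with () ← h refl

  moreDesirable-elim : ∀ i j → MoreDesirable W i j → lookup C j ≡ true → lookup C i ≡ true
  moreDesirable-elim i j i≽j j∈C with lookup C i in i∈C
  ... | true  = refl
  ... | false = contradiction (trans (sym i-gain) (i≽j R (lookup≡false⇒∉ R∌i) (lookup≡false⇒∉ R∌j) (trans j-gain strict)))
                              (not-¬ strict′)
    where
    witness = realise-avoiding C j∈C i∈C x₀< y₀<
    R = proj₁ witness
    R∌j = proj₁ (proj₂ witness)
    R∌i = proj₁ (proj₂ (proj₂ witness))
    R-profile = proj₂ (proj₂ (proj₂ witness))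
    j-gain : W (R ∪ ⁅ j ⁆) ≡ t (suc x₀) y₀
    j-gain = trans (countGame-∪⁅⁆ C t R j R∌j) (cong₂ (λ c p → uncurry t (bump c p)) j∈C R-profile)
    i-gain : W (R ∪ ⁅ i ⁆) ≡ t x₀ (suc y₀)
    i-gain = trans (countGame-∪⁅⁆ C t R i R∌i) (cong₂ (λ c p → uncurry t (bump c p)) i∈C R-profile)

  member : Σ[ i ∈ Fin n ] lookup C i ≡ true
  member = let i , i∈C , _ = count>0⇒common C ⊤ (≤-<-trans z≤n x₀<) in i , i∈C

  non-member : Σ[ j ∈ Fin n ] lookup (∁ C) j ≡ true
  non-member = let j , j∉C , _ = count>0⇒common (∁ C) ⊤ (≤-<-trans z≤n y₀<) in j , j∉C

  member⇒dominant : ∀ i → lookup C i ≡ true → Dominant W i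
  member⇒dominant i i∈C j = moreDesirable-intro i j (λ _ → i∈C)

  dominant⇒member : ∀ i → Dominant W i → lookup C i ≡ true
  dominant⇒member i i-dom = moreDesirable-elim i (proj₁ member) (i-dom (proj₁ member)) (proj₂ member)

  isSimpleGame : IsSimpleGame W
  isSimpleGame = top
               , (λ ⊥-wins → not-¬ bottom (trans (cong (uncurry t) (sym (profile-⊥ C))) ⊥-wins))
               , λ S T S⊆T → monotone (count-mono C S⊆T) (count-mono (∁ C) S⊆T)

  isComplete : IsComplete W
  isComplete = (λ i → moreDesirable-intro i i (λ i∈C → i∈C))
             , (λ i j k i≽j j≽k → moreDesirable-intro i k (moreDesirable-elim i j i≽j ∘ moreDesirable-elim j k j≽k))
             , total
    where
    total : ∀ i j → MoreDesirable W i j ⊎ MoreDesirable W j i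
    total i j with lookup C i in i∈C
    ... | true  = inj₁ (moreDesirable-intro i j (λ _ → i∈C))
    ... | false = inj₂ (moreDesirable-intro j i (λ i∈C′ → contradiction i∈C′ (not-¬ i∈C)))

  hasTwoClasses : HasTwoClasses W
  hasTwoClasses = C , ∁ C
                , (proj₁ member , lookup⇒[]= _ C (proj₂ member))
                , (proj₁ non-member , lookup⇒[]= _ (∁ C) (proj₂ non-member))
                , partition
                , (λ i j i∈C j∈C → equally i j (trans ([]=⇒lookup i∈C) (sym ([]=⇒lookup j∈C))))
                , (λ i j i∉C j∉C → equally i j (trans (∈∁⇒lookup≡false i∉C) (sym (∈∁⇒lookup≡false j∉C))))
                , strictly
    where
    partition : ∀ i → (i ∈ C × i ∉ ∁ C) ⊎ (i ∉ C × i ∈ ∁ C)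
    partition i with lookup C i in i∈C
    ... | true  = inj₁ (lookup⇒[]= i C i∈C , lookup≡false⇒∉ (trans (lookup-∁ C i) (cong not i∈C)))
    ... | false = inj₂ (lookup≡false⇒∉ i∈C , lookup⇒[]= i (∁ C) (trans (lookup-∁ C i) (cong not i∈C)))
    equally : ∀ i j → lookup C i ≡ lookup C j → EquallyDesirable W i j
    equally i j same S i∉S j∉S = moreDesirable-intro j i (λ i∈C → trans (sym same) i∈C) S j∉S i∉S
                               , moreDesirable-intro i j (λ j∈C → trans same j∈C) S i∉S j∉S
    strictly : ∀ i j → i ∈ C → j ∈ ∁ C → MoreDesirable W i j × ¬ MoreDesirable W j i
    strictly i j i∈C j∈∁C =
      moreDesirable-intro i j (λ _ → []=⇒lookup i∈C) ,
      λ j≽i → not-¬ (∈∁⇒lookup≡false j∈∁C) (moreDesirable-elim j i j≽i ([]=⇒lookup i∈C))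

  isCompleteTwoClassGame : CompleteTwoClassGame W
  isCompleteTwoClassGame = isSimpleGame , isComplete , hasTwoClasses

module _ {A : Set} {R : A → A → Set} where

  allPairs-∈ : ∀ {xs} {x y : A} → AllPairs R xs → x ∈ₗ xs → y ∈ₗ xs → x ≡ y ⊎ R x y ⊎ R y x
  allPairs-∈ (_ ∷ _)      (hereₗ refl) (hereₗ refl) = inj₁ refl
  allPairs-∈ (x≺ ∷ _)     (hereₗ refl) (thereₗ y∈) = inj₂ (inj₁ (All.lookup x≺ y∈))
  allPairs-∈ (y≺ ∷ _)     (thereₗ x∈) (hereₗ refl) = inj₂ (inj₂ (All.lookup y≺ x∈))
  allPairs-∈ (_ ∷ sorted) (thereₗ x∈) (thereₗ y∈) = allPairs-∈ sorted x∈ y∈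

  allPairs-≡ : Asymmetric R → ∀ {xs ys} → AllPairs R xs → AllPairs R ys →
               (∀ {z} → z ∈ₗ xs → z ∈ₗ ys) → (∀ {z} → z ∈ₗ ys → z ∈ₗ xs) → xs ≡ ys
  allPairs-≡ asym {[]}    {[]}    _ _ _ _ = refl
  allPairs-≡ asym {[]}    {y ∷ _} _ _ _ ys⊆xs with () ← ys⊆xs (hereₗ refl)
  allPairs-≡ asym {x ∷ _} {[]}    _ _ xs⊆ys _ with () ← xs⊆ys (hereₗ refl)
  allPairs-≡ asym {x ∷ xs} {y ∷ ys} (x≺ ∷ xs-sorted) (y≺ ∷ ys-sorted) xs⊆ys ys⊆xs =
    cong₂ _∷_ x≡y (allPairs-≡ asym xs-sorted ys-sorted (tail xs⊆ys x≺ x≡y) (tail ys⊆xs y≺ (sym x≡y)))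
    where
    x≡y : x ≡ y
    x≡y with xs⊆ys (hereₗ refl) | ys⊆xs (hereₗ refl)
    ... | hereₗ x≡y | _          = x≡y
    ... | thereₗ _  | hereₗ y≡x  = sym y≡x
    ... | thereₗ x∈ | thereₗ y∈  = contradiction (All.lookup x≺ y∈) (asym (All.lookup y≺ x∈))
    tail : ∀ {u v us vs} → (∀ {z} → z ∈ₗ u ∷ us → z ∈ₗ v ∷ vs) → All (R u) us → u ≡ v →
           ∀ {z} → z ∈ₗ us → z ∈ₗ vs
    tail sub u≺ refl z∈ with sub (thereₗ z∈)
    ... | thereₗ z∈′ = z∈′
    ... | hereₗ refl = contradiction (All.lookup u≺ z∈) (λ r → asym r r)

Row : Set
Row = ℕ × ℕ

rowSum : Row → ℕ
rowSum r = proj₁ r + proj₂ r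

_≺_ : Row → Row → Set
r ≺ s = proj₁ s < proj₁ r × rowSum r < rowSum s

-- A coalition with x voters of the top class and y others beats the row (p , q) when
-- x ≥ p and x + y ≥ p + q: voters of the top class may stand in for the others.
_≼_ : Row → Row → Set
r ≼ s = proj₁ r ≤ proj₁ s × rowSum r ≤ rowSum s

_≼?_ : Decidable _≼_
r ≼? s = (proj₁ r ≤? proj₁ s) ×-dec (rowSum r ≤? rowSum s)

≼-refl : ∀ {r} → r ≼ r
≼-refl = ≤-refl , ≤-refl

≼-trans : ∀ {r s u} → r ≼ s → s ≼ u → r ≼ u
≼-trans (p≤ , Σ≤) (p≤′ , Σ≤′) = ≤-trans p≤ p≤′ , ≤-trans Σ≤ Σ≤′

≼-antisym : ∀ {r s} → r ≼ s → s ≼ r → r ≡ s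
≼-antisym {p , q} {p′ , q′} (p≤ , Σ≤) (p≥ , Σ≥) with ≤-antisym p≤ p≥
... | refl = cong (p ,_) (+-cancelˡ-≡ p q q′ (≤-antisym Σ≤ Σ≥))

≺-asym : Asymmetric _≺_
≺-asym (p> , _) (p< , _) = <-asym p> p<

≺⇒⋠ : ∀ {r s} → r ≺ s → ¬ r ≼ s
≺⇒⋠ (p> , _) (p≤ , _) = <⇒≱ p> p≤

≺⇒⋡ : ∀ {r s} → r ≺ s → ¬ s ≼ r
≺⇒⋡ (_ , Σ<) (_ , Σ≤) = <⇒≱ Σ< Σ≤

does⇒ : ∀ {A : Set} (d : Dec A) → does d ≡ true → A
does⇒ (yes a) _ = a

matrixTable : Matrix2 → Table
matrixTable M x y = does (any? (_≼? (x , y)) M)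

module _ (M : Matrix2) {x y : ℕ} where

  matrixTable⁺ : Any (_≼ (x , y)) M → matrixTable M x y ≡ true
  matrixTable⁺ = dec-true (any? (_≼? (x , y)) M)

  matrixTable⁻ : matrixTable M x y ≡ true → Any (_≼ (x , y)) M
  matrixTable⁻ = does⇒ (any? (_≼? (x , y)) M)

  matrixTable-false : ¬ Any (_≼ (x , y)) M → matrixTable M x y ≡ false
  matrixTable-false = dec-false (any? (_≼? (x , y)) M)

matrixTable-monotone : ∀ M {x y x′ y′} → x ≤ x′ → y ≤ y′ →
                       matrixTable M x y ≡ true → matrixTable M x′ y′ ≡ true
matrixTable-monotone M x≤ y≤ wins =
  matrixTable⁺ M (Any.map (λ r≼ → ≼-trans r≼ (x≤ , +-mono-≤ x≤ y≤)) (matrixTable⁻ M wins))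

matrixTable-trade : ∀ M x y → matrixTable M x (suc y) ≡ true → matrixTable M (suc x) y ≡ true
matrixTable-trade M x y wins =
  matrixTable⁺ M (Any.map (λ r≼ → ≼-trans r≼ (n≤1+n x , ≤-reflexive (+-suc x y))) (matrixTable⁻ M wins))

row-wins : ∀ {M r} → r ∈ₗ M → matrixTable M (proj₁ r) (proj₂ r) ≡ true
row-wins {M} r∈ = matrixTable⁺ M (lose r∈ ≼-refl)

≼-antichain : ∀ {M r s} → AllPairs _≺_ M → r ∈ₗ M → s ∈ₗ M → r ≼ s → r ≡ s
≼-antichain sorted r∈ s∈ r≼s with allPairs-∈ sorted r∈ s∈
... | inj₁ r≡s        = r≡s
... | inj₂ (inj₁ r≺s) = contradiction r≼s (≺⇒⋠ r≺s)
... | inj₂ (inj₂ s≺r) = contradiction r≼s (≺⇒⋡ s≺r)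

beaten-after-head : ∀ {h rest s} → All (h ≺_) rest → Any (_≼ s) rest → rowSum h < rowSum s
beaten-after-head h≺ beaten =
  let r , r∈ , r≼s = find beaten in <-≤-trans (proj₂ (All.lookup h≺ r∈)) (proj₂ r≼s)

module _ {a b : ℕ} where

  valid-bounds : ∀ {M} → ValidMatrix a b M → All (λ r → proj₁ r ≤ a × proj₂ r ≤ b) M
  valid-bounds = proj₁ ∘ proj₂

  valid-sorted : ∀ {M} → ValidMatrix a b M → AllPairs _≺_ M
  valid-sorted {[]}        _                     = []
  valid-sorted {_ ∷ []}    _                     = [] ∷ []
  valid-sorted {_ ∷ _ ∷ _} (_ , _ , _ , sorted) = sorted (s≤s (s≤s z≤n))

  valid-head : ∀ {p q M} → ValidMatrix a b ((p , q) ∷ M) → 0 < p × q < b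
  valid-head {M = []} (_ , _ , single , _) = All.head (single refl)
  valid-head {p} {q} {(p′ , q′) ∷ M} (_ , _ ∷ (_ , q′≤b) ∷ _ , _ , sorted) with sorted (s≤s (s≤s z≤n))
  ... | ((p′<p , Σ<) ∷ _) ∷ _ =
    ≤-<-trans z≤n p′<p , <-≤-trans (+-cancelˡ-< p q q′ (<-≤-trans Σ< (+-monoˡ-≤ q′ (<⇒≤ p′<p)))) q′≤b

  matrixTable-top : ∀ {M} → ValidMatrix a b M → matrixTable M a b ≡ true
  matrixTable-top {r ∷ M} (_ , (p≤a , q≤b) ∷ _ , _) = matrixTable⁺ (r ∷ M) (hereₗ (p≤a , +-mono-≤ p≤a q≤b))

  matrixTable-bottom : ∀ {M} → ValidMatrix a b M → matrixTable M 0 0 ≡ false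
  matrixTable-bottom {h ∷ M} valid = matrixTable-false (h ∷ M) λ where
    (hereₗ (p≤0 , _)) → <⇒≱ (proj₁ (valid-head valid)) p≤0
    (thereₗ beaten)   → <⇒≱ (beaten-after-head (AllPairs.head (valid-sorted valid)) beaten) z≤n

  matrixTable-strict : ∀ {M} → ValidMatrix a b M →
    Σ[ x ∈ ℕ ] Σ[ y ∈ ℕ ] x < a × y < b × matrixTable M (suc x) y ≡ true × matrixTable M x (suc y) ≡ false
  matrixTable-strict {(zero , q) ∷ M} valid = contradiction (proj₁ (valid-head valid)) λ ()
  matrixTable-strict {(suc x , q) ∷ M} valid@(_ , (p≤a , _) ∷ _ , _) =
    x , q , p≤a , proj₂ (valid-head valid) , row-wins {(suc x , q) ∷ M} (hereₗ refl) , matrixTable-false ((suc x , q) ∷ M) λ where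
      (hereₗ (p≤x , _)) → <-irrefl refl p≤x
      (thereₗ beaten)   → <-irrefl (sym (+-suc x q)) (beaten-after-head (AllPairs.head (valid-sorted valid)) beaten)

  module _ {M M′} (valid : ValidMatrix a b M) (valid′ : ValidMatrix a b M′)
           (agree : ∀ x y → x ≤ a → y ≤ b → matrixTable M x y ≡ matrixTable M′ x y) where

    agree-at : ∀ {N s} → ValidMatrix a b N → s ∈ₗ N →
               matrixTable M (proj₁ s) (proj₂ s) ≡ matrixTable M′ (proj₁ s) (proj₂ s)
    agree-at valid s∈ = uncurry (agree _ _) (All.lookup (valid-bounds valid) s∈)

    rows-agree : ∀ {r} → r ∈ₗ M → r ∈ₗ M′
    rows-agree {r} r∈
      with r′ , r′∈ , r′≼r ← find (matrixTable⁻ M′ (trans (sym (agree-at valid r∈)) (row-wins r∈)))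
      with r″ , r″∈ , r″≼r′ ← find (matrixTable⁻ M (trans (agree-at valid′ r′∈) (row-wins r′∈)))
      with refl ← ≼-antichain (valid-sorted valid) r″∈ r∈ (≼-trans r″≼r′ r′≼r)
      = subst (_∈ₗ M′) (≼-antisym r′≼r r″≼r′) r′∈

  matrixTable-injective : ∀ {M M′} → ValidMatrix a b M → ValidMatrix a b M′ →
    (∀ x y → x ≤ a → y ≤ b → matrixTable M x y ≡ matrixTable M′ x y) → M ≡ M′
  matrixTable-injective valid valid′ agree =
    allPairs-≡ ≺-asym (valid-sorted valid) (valid-sorted valid′)
      (rows-agree valid valid′ agree) (rows-agree valid′ valid λ x y x≤ y≤ → sym (agree x y x≤ y≤))

module _ {C C′ : Subset n} {t t′ : Table} (T : IsTwoClassTable C t) (T′ : IsTwoClassTable C′ t′)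
         (I : Isomorphic (countGame C t) (countGame C′ t′)) where
  private
    π = proj₁ I
    W = countGame C t
    W′ = countGame C′ t′
    module T = TwoClassTable T
    module T′ = TwoClassTable T′

  image-class : image π C ≡ C′
  image-class = lookup-ext λ j → trans (lookup-image π C j) (trans (same-class (π ⟨$⟩ˡ j)) (cong (lookup C′) (inverseʳ π)))
    where
    same-class : ∀ i → lookup C i ≡ lookup C′ (π ⟨$⟩ʳ i)
    same-class i = ⇔→≡ (mk⇔
      (λ i∈C → T′.dominant⇒member _ (dominant-iso {W = W} {W′} I (T.member⇒dominant i i∈C)))
      (λ πi∈C′ → T.dominant⇒member i (dominant-iso⁻ {W = W} {W′} I (T′.member⇒dominant _ πi∈C′))))

  tables-agree : ∀ x y → x ≤ count C ⊤ → y ≤ count (∁ C) ⊤ → t x y ≡ t′ x y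
  tables-agree x y x≤ y≤ = begin
    t x y                                            ≡⟨ cong (uncurry t) (realise C x≤ y≤) ⟨
    countGame C t S                                  ≡⟨ ⇔→≡ (mk⇔ (proj₁ (proj₂ I S)) (proj₂ (proj₂ I S))) ⟩
    countGame C′ t′ (image π S)                      ≡⟨ cong (λ D → uncurry t′ (profile D (image π S))) image-class ⟨
    uncurry t′ (profile (image π C) (image π S))     ≡⟨ cong (uncurry t′) (trans (profile-image π C S) (realise C x≤ y≤)) ⟩
    t′ x y                                           ∎
    where
    open ≡-Reasoning
    S = pick C ⊤ x y

canonicalGame : (n : ℕ) → ℕ → Matrix2 → Family n
canonicalGame n a M = countGame (prefix a n) (matrixTable M)

canonical-isTwoClassTable : ∀ {a M} → a ≤ n → ValidMatrix a (n ∸ a) M → IsTwoClassTable (prefix a n) (matrixTable M)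
canonical-isTwoClassTable {n} {a} {M} a≤n valid
  with x₀ , y₀ , x₀<a , y₀<b , strict , strict′ ← matrixTable-strict valid = record
  { monotone = matrixTable-monotone M
  ; trade    = matrixTable-trade M
  ; top      = trans (cong (uncurry (matrixTable M)) box) (matrixTable-top valid)
  ; bottom   = matrixTable-bottom valid
  ; x₀       = x₀
  ; y₀       = y₀
  ; x₀<      = subst (x₀ <_) (sym (cong proj₁ box)) x₀<a
  ; y₀<      = subst (y₀ <_) (sym (cong proj₂ box)) y₀<b
  ; strict   = strict
  ; strict′  = strict′
  }
  where
  box = profile-prefix a n a≤n

canonical-iso⇒same-size : ∀ {a a′ M M′} (a≤n : a ≤ n) (a′≤n : a′ ≤ n)
  (valid : ValidMatrix a (n ∸ a) M) (valid′ : ValidMatrix a′ (n ∸ a′) M′) →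
  Isomorphic (canonicalGame n a M) (canonicalGame n a′ M′) → a ≡ a′
canonical-iso⇒same-size {n} {a} {a′} a≤n a′≤n valid valid′ I = begin
  a                                                          ≡⟨ cong proj₁ (profile-prefix a n a≤n) ⟨
  count (prefix a n) ⊤                                       ≡⟨ count-image π (prefix a n) ⊤ ⟨
  count (image π (prefix a n)) (image π ⊤)                   ≡⟨ cong₂ count (image-class T T′ I) (image-⊤ π) ⟩
  count (prefix a′ n) ⊤                                      ≡⟨ cong proj₁ (profile-prefix a′ n a′≤n) ⟩
  a′                                                         ∎
  where
  open ≡-Reasoning
  π = proj₁ I
  T  = canonical-isTwoClassTable a≤n valid
  T′ = canonical-isTwoClassTable a′≤n valid′

canonical-unique : ∀ {a a′ M M′} → a ≤ n → a′ ≤ n → ValidMatrix a (n ∸ a) M → ValidMatrix a′ (n ∸ a′) M′ →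
                   Isomorphic (canonicalGame n a M) (canonicalGame n a′ M′) → (a , M) ≡ (a′ , M′)
canonical-unique {n} {a} {a′} {M} {M′} a≤n a′≤n valid valid′ I
  with refl ← canonical-iso⇒same-size a≤n a′≤n valid valid′ I =
  cong (a ,_) (matrixTable-injective valid valid′ λ x y x≤ y≤ →
    tables-agree T T′ I x y (subst (x ≤_) (sym (cong proj₁ box)) x≤) (subst (y ≤_) (sym (cong proj₂ box)) y≤))
  where
  T  = canonical-isTwoClassTable a≤n valid
  T′ = canonical-isTwoClassTable a′≤n valid′
  box = profile-prefix a n a≤n

least : (ℕ → Bool) → ℕ → Maybe ℕ
least f zero    = nothing
least f (suc k) = least f k <∣> (if f k then just k else nothing)

module _ (f : ℕ → Bool) where

  least-nothing : ∀ k → least f k ≡ nothing → ∀ {z} → z < k → f z ≡ false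
  least-nothing (suc k) none z<1+k with least f k in eq | f k in fk
  least-nothing (suc k) () z<1+k | just _  | _
  least-nothing (suc k) () z<1+k | nothing | true
  ... | nothing | false with m≤n⇒m<n∨m≡n (≤-pred z<1+k)
  ... | inj₁ z<k  = least-nothing k eq z<k
  ... | inj₂ refl = fk

  least-just : ∀ k {z} → least f k ≡ just z → f z ≡ true × z < k
  least-just (suc k) found with least f k in eq | f k in fk
  least-just (suc k) refl | just _  | _    = map₂ m<n⇒m<1+n (least-just k eq)
  least-just (suc k) refl | nothing | true = fk , ≤-refl

  least-minimal : ∀ k {z z′} → least f k ≡ just z → f z′ ≡ true → z ≤ z′
  least-minimal (suc k) found fz′ with least f k in eq | f k in fk
  least-minimal (suc k) refl fz′ | just _  | _    = least-minimal k eq fz′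
  least-minimal (suc k) {z′ = z′} refl fz′ | nothing | true with k ≤? z′
  ... | yes k≤z′ = k≤z′
  ... | no  k≰z′ = contradiction fz′ (not-¬ (least-nothing k eq (≰⇒> k≰z′)))

TradesReversible : ℕ → ℕ → Table → Set
TradesReversible a b t = ∀ x y → x < a → y < b → t (suc x) y ≡ true → t x (suc y) ≡ true

single-row-reversible : ∀ {a b r} → (∀ {x y} → y < b → r ≼ (suc x , y) → r ≼ (x , suc y)) →
                        TradesReversible a b (matrixTable (r ∷ []))
single-row-reversible {r = r} step x y _ y<b wins with matrixTable⁻ (r ∷ []) wins
... | hereₗ r≼ = matrixTable⁺ (r ∷ []) (hereₗ (step y<b r≼))

-- a row (0 , q) or (p , b) does not tell the two classes apart
single-row-valid : ∀ {a b p q} → q ≤ b → ¬ TradesReversible a b (matrixTable ((p , q) ∷ [])) → 0 < p × q < b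
single-row-valid {p = zero} {q} q≤b irreversible =
  contradiction (single-row-reversible {r = zero , q} λ _ (_ , Σ≤) → z≤n , ≤-trans Σ≤ (≤-reflexive (sym (+-suc _ _)))) irreversible
single-row-valid {b = b} {suc p} {q} q≤b irreversible with q <? b
... | yes q<b = s≤s z≤n , q<b
... | no  q≮b with ≤-antisym q≤b (≮⇒≥ q≮b)
...   | refl = contradiction (single-row-reversible {r = suc p , q} λ {x} {y} y<b (_ , Σ≤) →
                 head≤x y<b Σ≤ , ≤-trans Σ≤ (≤-reflexive (sym (+-suc x y)))) irreversible
  where
  head≤x : ∀ {x y} → y < q → suc p + q ≤ suc x + y → suc p ≤ x
  head≤x {x} {y} y<q Σ≤ = +-cancelʳ-≤ q (suc p) x (begin
    suc p + q   ≤⟨ Σ≤ ⟩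
    suc x + y   ≡⟨ +-suc x y ⟨
    x + suc y   ≤⟨ +-monoʳ-≤ x y<q ⟩
    x + q       ∎)
    where open ≤-Reasoning

module Extraction (a b : ℕ) (t : Table)
  (grow-x : ∀ {x y} → x < a → y ≤ b → t x y ≡ true → t (suc x) y ≡ true)
  (grow-y : ∀ {x y} → x ≤ a → y < b → t x y ≡ true → t x (suc y) ≡ true)
  (trade  : ∀ {x y} → x < a → y < b → t x (suc y) ≡ true → t (suc x) y ≡ true)
  where

  grow-x* : ∀ {p x y} → p ≤ x → x ≤ a → y ≤ b → t p y ≡ true → t x y ≡ true
  grow-x* {x = zero}  z≤n _ _ win = win
  grow-x* {x = suc x} p≤ x<a y≤b win with m≤n⇒m<n∨m≡n p≤
  ... | inj₂ refl      = win
  ... | inj₁ (s≤s p≤x) = grow-x x<a y≤b (grow-x* p≤x (<⇒≤ x<a) y≤b win)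

  grow-y* : ∀ {q x y} → q ≤ y → x ≤ a → y ≤ b → t x q ≡ true → t x y ≡ true
  grow-y* {y = zero}  z≤n _ _ win = win
  grow-y* {y = suc y} q≤ x≤a y<b win with m≤n⇒m<n∨m≡n q≤
  ... | inj₂ refl      = win
  ... | inj₁ (s≤s q≤y) = grow-y x≤a y<b (grow-y* q≤y x≤a (<⇒≤ y<b) win)

  -- trade away the surplus of the second column, then grow both columns
  dominating-wins : ∀ {p} q {x y} → (p , q) ≼ (x , y) → x ≤ a → y ≤ b → q ≤ b → t p q ≡ true → t x y ≡ true
  dominating-wins {p} q {x} {y} (p≤x , Σ≤) x≤a y≤b q≤b win with q ≤? y
  ... | yes q≤y = grow-y* q≤y x≤a y≤b (grow-x* p≤x x≤a q≤b win)
  dominating-wins {p} zero    (p≤x , Σ≤) x≤a y≤b q≤b win | no q≰y = contradiction z≤n q≰y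
  dominating-wins {p} (suc q) {x} {y} (p≤x , Σ≤) x≤a y≤b q<b win | no q≰y =
    dominating-wins q (p<x , ≤-trans (≤-reflexive (sym (+-suc p q))) Σ≤) x≤a y≤b (<⇒≤ q<b)
      (trade (<-≤-trans p<x x≤a) q<b win)
    where
    p<x : p < x
    p<x = +-cancelʳ-≤ q (suc p) x (begin
      suc p + q  ≡⟨ +-suc p q ⟨
      p + suc q  ≤⟨ Σ≤ ⟩
      x + y      ≤⟨ +-monoʳ-≤ x (≤-pred (≰⇒> q≰y)) ⟩
      x + q      ∎)
      where open ≤-Reasoning

  column : ℕ → Maybe ℕ
  column x = least (t x) (suc b)

  improves : ℕ → Matrix2 → Bool
  improves s []      = true
  improves s (r ∷ _) = does (s <? rowSum r)

  addColumn : ℕ → Maybe ℕ → Matrix2 → Matrix2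
  addColumn x nothing  rows = rows
  addColumn x (just y) rows = if improves (x + y) rows then (x , y) ∷ rows else rows

  -- the rows with first entry below X
  build : ℕ → Matrix2
  build zero    = []
  build (suc X) = addColumn X (column X) (build X)

  WinningRow : ℕ → Row → Set
  WinningRow X r = proj₁ r < X × proj₁ r ≤ a × proj₂ r ≤ b × t (proj₁ r) (proj₂ r) ≡ true

  record Invariant (X : ℕ) (rows : Matrix2) : Set where
    field
      winning : All (WinningRow X) rows
      sorted  : AllPairs _≺_ rows
      covers  : ∀ x y → x < X → y ≤ b → t x y ≡ true → Any (_≼ (x , y)) rows

  winning-suc : ∀ {X rows} → All (WinningRow X) rows → All (WinningRow (suc X)) rows
  winning-suc = All.map (map₁ m<n⇒m<1+n)

  improves⇒≺ : ∀ {X y rows} → improves (X + y) rows ≡ true → All (WinningRow X) rows → AllPairs _≺_ rows →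
               All ((X , y) ≺_) rows
  improves⇒≺ {rows = []}    _ _ _ = []
  improves⇒≺ {X} {y} {rows = r ∷ rows} better ((r<X , _) ∷ winning) (r≺ ∷ _) =
    (r<X , Σ<) ∷ All.zipWith (λ { ((s<X , _) , (_ , Σr<Σs)) → s<X , <-trans Σ< Σr<Σs }) (winning , r≺)
    where
    Σ< : X + y < rowSum r
    Σ< = does⇒ (X + y <? rowSum r) better

  covers-suc : ∀ {X rows} → (∀ x y → x < X → y ≤ b → t x y ≡ true → Any (_≼ (x , y)) rows) →
               (∀ y → y ≤ b → t X y ≡ true → Any (_≼ (X , y)) rows) →
               ∀ x y → x < suc X → y ≤ b → t x y ≡ true → Any (_≼ (x , y)) rows
  covers-suc old new x y x<1+X y≤b win with m≤n⇒m<n∨m≡n (≤-pred x<1+X)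
  ... | inj₁ x<X  = old x y x<X y≤b win
  ... | inj₂ refl = new y y≤b win

  invariant-step : ∀ X {rows} → X ≤ a → Invariant X rows → Invariant (suc X) (addColumn X (column X) rows)
  invariant-step X {rows} X≤a inv with column X in found
  ... | nothing = record
    { winning = winning-suc winning
    ; sorted  = sorted
    ; covers  = covers-suc covers λ y y≤b win → contradiction win (not-¬ (least-nothing (t X) (suc b) found (s≤s y≤b)))
    }
    where open Invariant inv
  ... | just y with improves (X + y) rows in better
  ...   | true = record
    { winning = (≤-refl , X≤a , ≤-pred y<1+b , y-wins) ∷ winning-suc winning
    ; sorted  = improves⇒≺ better winning sorted ∷ sorted
    ; covers  = covers-suc (λ x y′ x<X y′≤b win → thereₗ (covers x y′ x<X y′≤b win))
                           λ y′ _ win → hereₗ (≤-refl , +-monoʳ-≤ X (least-minimal (t X) (suc b) found win))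
    }
    where
    open Invariant inv
    y-wins = proj₁ (least-just (t X) (suc b) found)
    y<1+b  = proj₂ (least-just (t X) (suc b) found)
  invariant-step X {r ∷ rows} X≤a inv | just y | false = record
    { winning = winning-suc winning
    ; sorted  = sorted
    ; covers  = covers-suc covers λ y′ _ win →
        hereₗ (<⇒≤ (proj₁ (All.head winning))
              , ≤-trans (≮⇒≥ (λ Σ< → not-¬ better (dec-true (X + y <? rowSum r) Σ<)))
                        (+-monoʳ-≤ X (least-minimal (t X) (suc b) found win)))
    }
    where open Invariant inv

  invariant : ∀ X → X ≤ suc a → Invariant X (build X)
  invariant zero    _      = record { winning = [] ; sorted = [] ; covers = λ _ _ () }
  invariant (suc X) X<1+a = invariant-step X (≤-pred X<1+a) (invariant X (<⇒≤ X<1+a))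

  matrix : Matrix2
  matrix = build (suc a)

  open Invariant (invariant (suc a) ≤-refl)

  matrix-agrees : ∀ x y → x ≤ a → y ≤ b → t x y ≡ matrixTable matrix x y
  matrix-agrees x y x≤a y≤b = ⇔→≡ (mk⇔ (matrixTable⁺ matrix ∘ covers x y (s≤s x≤a) y≤b) beaten⇒wins)
    where
    beaten⇒wins : matrixTable matrix x y ≡ true → t x y ≡ true
    beaten⇒wins beaten with find (matrixTable⁻ matrix beaten)
    ... | (p , q) , r∈ , r≼ = let (_ , _ , q≤b , win) = All.lookup winning r∈ in
                              dominating-wins q r≼ x≤a y≤b q≤b win

  matrix-nonempty : t a b ≡ true → 1 ≤ length matrix
  matrix-nonempty top with matrix | covers a b ≤-refl ≤-refl top
  ... | _ ∷ _ | _ = s≤s z≤n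

  matrix-bounds : All (λ r → proj₁ r ≤ a × proj₂ r ≤ b) matrix
  matrix-bounds = All.map (λ (_ , p≤a , q≤b , _) → p≤a , q≤b) winning

  matrix-valid : t a b ≡ true → ¬ TradesReversible a b t → ValidMatrix a b matrix
  matrix-valid top irreversible = matrix-nonempty top , matrix-bounds , single matrix matrix-bounds matrix-agrees , λ _ → sorted
    where
    single : ∀ M → All (λ r → proj₁ r ≤ a × proj₂ r ≤ b) M → (∀ x y → x ≤ a → y ≤ b → t x y ≡ matrixTable M x y) →
             length M ≡ 1 → All (λ r → 0 < proj₁ r × proj₂ r < b) M
    single (r ∷ []) ((_ , q≤b) ∷ []) agrees _ = single-row-valid q≤b (irreversible ∘ transfer) ∷ []
      where
      transfer : TradesReversible a b (matrixTable (r ∷ [])) → TradesReversible a b t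
      transfer reversible x y x<a y<b wins =
        trans (agrees x (suc y) (<⇒≤ x<a) y<b)
              (reversible x y x<a y<b (trans (sym (agrees (suc x) y x<a (<⇒≤ y<b))) wins))

-- Every complete game with two classes is isomorphic to a canonical one

module Classification {W : Family n} (simple : IsSimpleGame W) {N₁ N₂ : Subset n}
  (i₀ j₀ : Fin n) (i₀∈N₁ : i₀ ∈ N₁) (j₀∈N₂ : j₀ ∈ N₂)
  (partition : ∀ i → (i ∈ N₁ × i ∉ N₂) ⊎ (i ∉ N₁ × i ∈ N₂))
  (equal₁ : ∀ i j → i ∈ N₁ → j ∈ N₁ → EquallyDesirable W i j)
  (equal₂ : ∀ i j → i ∈ N₂ → j ∈ N₂ → EquallyDesirable W i j)
  (strict : ∀ i j → i ∈ N₁ → j ∈ N₂ → MoreDesirable W i j × ¬ MoreDesirable W j i)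
  where

  ∉N₁⇒∈N₂ : ∀ {i} → lookup N₁ i ≡ false → i ∈ N₂
  ∉N₁⇒∈N₂ {i} i∉N₁ with partition i
  ... | inj₁ (i∈N₁ , _) = contradiction ([]=⇒lookup i∈N₁) (not-¬ i∉N₁)
  ... | inj₂ (_ , i∈N₂) = i∈N₂

  ∈N₂⇒∉N₁ : ∀ {i} → i ∈ N₂ → lookup N₁ i ≡ false
  ∈N₂⇒∉N₁ {i} i∈N₂ with partition i
  ... | inj₁ (_ , i∉N₂) = contradiction i∈N₂ i∉N₂
  ... | inj₂ (i∉N₁ , _) = ∉⇒lookup≡false i∉N₁

  equallyDesirable⇒same : ∀ {i j} R → EquallyDesirable W i j → lookup R i ≡ false → lookup R j ≡ false →
                          W (R ∪ ⁅ i ⁆) ≡ W (R ∪ ⁅ j ⁆)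
  equallyDesirable⇒same R eq i∉R j∉R =
    let i⇒j , j⇒i = eq R (lookup≡false⇒∉ i∉R) (lookup≡false⇒∉ j∉R) in ⇔→≡ (mk⇔ i⇒j j⇒i)

  swapInvariant : SwapInvariant N₁ W
  swapInvariant R i j same i∉R j∉R with lookup N₁ i in i∈ | lookup N₁ j in j∈
  ... | true  | true  = equallyDesirable⇒same R (equal₁ i j (lookup⇒[]= i N₁ i∈) (lookup⇒[]= j N₁ j∈)) i∉R j∉R
  ... | false | false = equallyDesirable⇒same R (equal₂ i j (∉N₁⇒∈N₂ i∈) (∉N₁⇒∈N₂ j∈)) i∉R j∉R

  a b : ℕ
  a = count N₁ ⊤
  b = count (∁ N₁) ⊤

  t : Table
  t x y = W (pick N₁ ⊤ x y)

  W-profile : ∀ S → W S ≡ uncurry t (profile N₁ S)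
  W-profile S = profile-determines N₁ W swapInvariant S _
    (sym (realise N₁ (count≤count-⊤ N₁ S) (count≤count-⊤ (∁ N₁) S)))

  profile-box : ∀ S → count N₁ S ≤ a × count (∁ N₁) S ≤ b
  profile-box S = count≤count-⊤ N₁ S , count≤count-⊤ (∁ N₁) S

  grow : ∀ c {x y} → proj₁ (bump c (x , y)) ≤ a → proj₂ (bump c (x , y)) ≤ b →
         t x y ≡ true → uncurry t (bump c (x , y)) ≡ true
  grow c {x} {y} x′≤a y′≤b win =
    let k , k∈c , k∈S = bump-profile⇒member c N₁ S S-profile
        R-profile : profile N₁ (remove S k) ≡ (x , y)
        R-profile = sym (bump-injective c (trans S-profile
          (trans (profile-remove N₁ S k k∈S) (cong (λ d → bump d (profile N₁ (remove S k))) k∈c))))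
    in proj₂ (proj₂ simple) _ S (remove-⊆ S k) (trans (W-profile _) (trans (cong (uncurry t) R-profile) win))
    where
    S = pick N₁ ⊤ (proj₁ (bump c (x , y))) (proj₂ (bump c (x , y)))
    S-profile : bump c (x , y) ≡ profile N₁ S
    S-profile = sym (realise N₁ x′≤a y′≤b)

  i₀∈ : lookup N₁ i₀ ≡ true
  i₀∈ = []=⇒lookup i₀∈N₁

  j₀∉ : lookup N₁ j₀ ≡ false
  j₀∉ = ∈N₂⇒∉N₁ j₀∈N₂

  profile-with-i₀ : ∀ R → lookup R i₀ ≡ false → profile N₁ (R ∪ ⁅ i₀ ⁆) ≡ map₁ suc (profile N₁ R)
  profile-with-i₀ R i₀∉R = trans (profile-∪⁅⁆ N₁ R i₀ i₀∉R) (cong (λ c → bump c _) i₀∈)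

  profile-with-j₀ : ∀ R → lookup R j₀ ≡ false → profile N₁ (R ∪ ⁅ j₀ ⁆) ≡ map₂ suc (profile N₁ R)
  profile-with-j₀ R j₀∉R = trans (profile-∪⁅⁆ N₁ R j₀ j₀∉R) (cong (λ c → bump c _) j₀∉)

  with-i₀ : ∀ R → lookup R i₀ ≡ false → W (R ∪ ⁅ i₀ ⁆) ≡ uncurry t (map₁ suc (profile N₁ R))
  with-i₀ R i₀∉R = trans (W-profile _) (cong (uncurry t) (profile-with-i₀ R i₀∉R))

  with-j₀ : ∀ R → lookup R j₀ ≡ false → W (R ∪ ⁅ j₀ ⁆) ≡ uncurry t (map₂ suc (profile N₁ R))
  with-j₀ R j₀∉R = trans (W-profile _) (cong (uncurry t) (profile-with-j₀ R j₀∉R))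

  trade : ∀ {x y} → x < a → y < b → t x (suc y) ≡ true → t (suc x) y ≡ true
  trade x<a y<b win =
    let R , R∌i₀ , R∌j₀ , R-profile = realise-avoiding N₁ i₀∈ j₀∉ x<a y<b
        at : ∀ f → uncurry t (f (profile N₁ R)) ≡ uncurry t (f _)
        at f = cong (uncurry t ∘ f) R-profile
    in trans (sym (trans (with-i₀ R R∌i₀) (at (map₁ suc))))
             (proj₁ (strict i₀ j₀ i₀∈N₁ j₀∈N₂) R (lookup≡false⇒∉ R∌i₀) (lookup≡false⇒∉ R∌j₀)
               (trans (with-j₀ R R∌j₀) (trans (at (map₂ suc)) win)))

  irreversible : ¬ TradesReversible a b t
  irreversible reversible = proj₂ (strict i₀ j₀ i₀∈N₁ j₀∈N₂) λ S j₀∉S i₀∉S S+i₀-wins →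
    let S∌j₀ = ∉⇒lookup≡false j₀∉S
        S∌i₀ = ∉⇒lookup≡false i₀∉S
        x<a = subst (_≤ a) (cong proj₁ (profile-with-i₀ S S∌i₀)) (proj₁ (profile-box (S ∪ ⁅ i₀ ⁆)))
        y<b = subst (_≤ b) (cong proj₂ (profile-with-j₀ S S∌j₀)) (proj₂ (profile-box (S ∪ ⁅ j₀ ⁆)))
    in trans (with-j₀ S S∌j₀) (reversible _ _ x<a y<b (trans (sym (with-i₀ S S∌i₀)) S+i₀-wins))

  open Extraction a b t (grow true) (grow false) trade

  M : Matrix2
  M = matrix

  M-valid : ValidMatrix a (n ∸ a) M
  M-valid = subst (λ b → ValidMatrix a b matrix) (count-∁-⊤ N₁)
                        (matrix-valid (trans (sym (W-profile ⊤)) (proj₁ simple)) irreversible)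

  W≅canonical : Isomorphic W (canonicalGame n a M)
  W≅canonical = π , λ S → (λ w → trans (sym (same S)) w) , (λ w → trans (same S) w)
    where
    π = sortPerm N₁
    same : ∀ S → W S ≡ canonicalGame n a matrix (image π S)
    same S = begin
      W S                                                     ≡⟨ W-profile S ⟩
      uncurry t (profile N₁ S)                                ≡⟨ uncurry (matrix-agrees _ _) (profile-box S) ⟩
      uncurry (matrixTable matrix) (profile N₁ S)             ≡⟨ cong (uncurry (matrixTable matrix)) (profile-image π N₁ S) ⟨
      uncurry (matrixTable matrix) (profile (image π N₁) (image π S))
        ≡⟨ cong (λ C → uncurry (matrixTable matrix) (profile C (image π S))) (image-sortPerm N₁) ⟩
      canonicalGame n a matrix (image π S)                    ∎
      where open ≡-Reasoning

  1≤a : 1 ≤ a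
  1≤a = subst (1 ≤_) (sym (cong proj₁ (trans (profile-remove N₁ ⊤ i₀ (lookup-⊤ i₀))
                                              (cong (λ c → bump c (profile N₁ (remove ⊤ i₀))) i₀∈))))
              (s≤s z≤n)

classify : {W : Family n} → CompleteTwoClassGame W →
  Σ[ a ∈ ℕ ] Σ[ M ∈ Matrix2 ] 1 ≤ a × a ≤ n × ValidMatrix a (n ∸ a) M × Isomorphic W (canonicalGame n a M)
classify (simple , _ , N₁ , N₂ , (i₀ , i₀∈N₁) , (j₀ , j₀∈N₂) , partition , equal₁ , equal₂ , strict) =
  a , M , 1≤a , count-⊤≤ N₁ , M-valid , W≅canonical
  where open Classification simple i₀ j₀ i₀∈N₁ j₀∈N₂ partition equal₁ equal₂ strict

-- Enumerating the valid matrices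

interval : ℕ → ℕ → List ℕ
interval m zero    = []
interval m (suc k) = m ∷ interval (suc m) k

∈-interval⁻ : ∀ m k {q} → q ∈ₗ interval m k → m ≤ q × q < m + k
∈-interval⁻ m (suc k) (hereₗ refl) = ≤-refl , ≤-<-trans (m≤m+n m k) (≤-reflexive (sym (+-suc m k)))
∈-interval⁻ m (suc k) (thereₗ q∈) =
  let m<q , q< = ∈-interval⁻ (suc m) k q∈ in <⇒≤ m<q , <-≤-trans q< (≤-reflexive (sym (+-suc m k)))

∈-interval⁺ : ∀ m k {q} → m ≤ q → q < m + k → q ∈ₗ interval m k
∈-interval⁺ m zero    m≤q q< = contradiction (<-≤-trans q< (≤-reflexive (+-identityʳ m))) (≤⇒≯ m≤q)
∈-interval⁺ m (suc k) m≤q q< with m≤n⇒m<n∨m≡n m≤q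
... | inj₂ refl = hereₗ refl
... | inj₁ m<q  = thereₗ (∈-interval⁺ (suc m) k m<q (<-≤-trans q< (≤-reflexive (+-suc m k))))

interval-unique : ∀ m k → Unique (interval m k)
interval-unique m zero    = []
interval-unique m (suc k) = All.tabulate (λ q∈ → <⇒≢ (proj₁ (∈-interval⁻ (suc m) k q∈))) ∷ interval-unique (suc m) k

length-interval : ∀ m k → length (interval m k) ≡ k
length-interval m zero    = refl
length-interval m (suc k) = cong suc (length-interval (suc m) k)

between : ℕ → ℕ → List ℕ
between m b = interval m (suc b ∸ m)

∈-between⁻ : ∀ m b {q} → q ∈ₗ between m b → m ≤ q × q ≤ b
∈-between⁻ m b {q} q∈ with m ≤? suc b
... | yes m≤1+b = let m≤q , q< = ∈-interval⁻ m (suc b ∸ m) q∈ in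
                  m≤q , ≤-pred (<-≤-trans q< (≤-reflexive (m+[n∸m]≡n m≤1+b)))
... | no  m≰1+b with () ← subst (λ k → q ∈ₗ interval m k) (m≤n⇒m∸n≡0 (<⇒≤ (≰⇒> m≰1+b))) q∈

∈-between⁺ : ∀ m b {q} → m ≤ q → q ≤ b → q ∈ₗ between m b
∈-between⁺ m b m≤q q≤b =
  ∈-interval⁺ m (suc b ∸ m) m≤q (≤-trans (s≤s q≤b) (≤-reflexive (sym (m+[n∸m]≡n (≤-trans m≤q (m≤n⇒m≤1+n q≤b))))))

module _ {A B : Set} (f : A → List B) where

  concatMap-unique : ∀ {xs} → Unique xs → (∀ x → Unique (f x)) → (∀ {x y v} → v ∈ₗ f x → v ∈ₗ f y → x ≡ y) →
                     Unique (concatMap f xs)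
  concatMap-unique {[]}     _          _      _    = []
  concatMap-unique {x ∷ xs} (x∉ ∷ xs!) f-uniq f-dis =
    Unique.++⁺ (f-uniq x) (concatMap-unique xs! f-uniq f-dis) λ (v∈fx , v∈rest) →
      let y , y∈xs , v∈fy = find (∈-concatMap⁻ f v∈rest) in All.lookup x∉ y∈xs (f-dis v∈fx v∈fy)

  length-concatMap : ∀ xs → length (concatMap f xs) ≡ sum (map (length ∘ f) xs)
  length-concatMap []       = refl
  length-concatMap (x ∷ xs) = trans (length-++ (f x)) (cong (length (f x) +_) (length-concatMap xs))

∷-map-unique : ∀ {A : Set} (r : A) {xss} → Unique xss → Unique (map (r ∷_) xss)
∷-map-unique r = Unique.map⁺ ∷-injectiveʳ

-- rows with first entry below P, second entry at most b and row sum at least m + P ∸ 1;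
-- so m is the least second entry allowed next to the first entry P ∸ 1
InRegion : ℕ → ℕ → ℕ → Row → Set
InRegion b P m r = proj₁ r < P × proj₂ r ≤ b × m + P ≤ suc (rowSum r)

Chain : ℕ → ℕ → ℕ → Matrix2 → Set
Chain b P m M = All (InRegion b P m) M × AllPairs _≺_ M

module _ {b P m : ℕ} where

  region-shift⁺ : ∀ {r} → InRegion b P (suc m) r → InRegion b (suc P) m r
  region-shift⁺ (p< , q≤ , Σ≥) = m<n⇒m<1+n p< , q≤ , ≤-trans (≤-reflexive (+-suc m P)) Σ≥

  region-shift⁻ : ∀ {r} → proj₁ r < P → InRegion b (suc P) m r → InRegion b P (suc m) r
  region-shift⁻ p< (_ , q≤ , Σ≥) = p< , q≤ , ≤-trans (≤-reflexive (sym (+-suc m P))) Σ≥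

  region-head⁺ : ∀ {q} → m ≤ q → q ≤ b → InRegion b (suc P) m (P , q)
  region-head⁺ {q} m≤q q≤b = ≤-refl , q≤b , (begin
    m + suc P    ≡⟨ +-suc m P ⟩
    suc (m + P)  ≤⟨ s≤s (+-monoˡ-≤ P m≤q) ⟩
    suc (q + P)  ≡⟨ cong suc (+-comm q P) ⟩
    suc (P + q)  ∎)
    where open ≤-Reasoning

  region-head⁻ : ∀ {q} → InRegion b (suc P) m (P , q) → m ≤ q
  region-head⁻ {q} (_ , _ , Σ≥) = +-cancelʳ-≤ P m q (≤-pred (begin
    suc (m + P)  ≡⟨ +-suc m P ⟨
    m + suc P    ≤⟨ Σ≥ ⟩
    suc (P + q)  ≡⟨ cong suc (+-comm P q) ⟩
    suc (q + P)  ∎))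
    where open ≤-Reasoning

  region-tail-widen : ∀ {q r} → m ≤ q → InRegion b P (2 + q) r → InRegion b (suc P) m r
  region-tail-widen {q} m≤q (p< , q≤ , Σ≥) = m<n⇒m<1+n p< , q≤ , ≤-trans (≤-reflexive (+-suc m P))
    (≤-trans (s≤s (+-monoˡ-≤ P m≤q)) (≤-trans (n≤1+n _) Σ≥))

region-tail⁺ : ∀ {b P q r} → proj₂ r ≤ b → (P , q) ≺ r → InRegion b P (2 + q) r
region-tail⁺ {P = P} {q} q≤ (p< , Σ<) = p< , q≤ , s≤s (≤-trans (≤-reflexive (cong suc (+-comm q P))) Σ<)

region-tail⁻ : ∀ {b P q r} → InRegion b P (2 + q) r → (P , q) ≺ r
region-tail⁻ {P = P} {q} (p< , _ , Σ≥) = p< , ≤-trans (≤-reflexive (cong suc (+-comm P q))) (≤-pred Σ≥)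

mutual
  chains : ℕ → ℕ → ℕ → List Matrix2
  chains b zero    m = []
  chains b (suc P) m = chains b P (suc m) ++ concatMap (headed b P) (between m b)

  headed : ℕ → ℕ → ℕ → List Matrix2
  headed b P q = ((P , q) ∷ []) ∷ headedLong b P q

  headedLong : ℕ → ℕ → ℕ → List Matrix2
  headedLong b P q = map ((P , q) ∷_) (chains b P (2 + q))

module _ (b : ℕ) where

  chains-sound : ∀ P m {M} → M ∈ₗ chains b P m → 1 ≤ length M × Chain b P m M
  chains-sound (suc P) m M∈ with ∈-++⁻ (chains b P (suc m)) M∈
  ... | inj₁ M∈ˡ = let ne , region , sorted = chains-sound P (suc m) M∈ˡ in
                   ne , All.map region-shift⁺ region , sorted
  ... | inj₂ M∈ʳ with find (∈-concatMap⁻ (headed b P) M∈ʳ)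
  ...   | q , q∈ , M∈′ with ∈-between⁻ m b q∈ | ∈-map⁻ ((P , q) ∷_) M∈′
  ...     | m≤q , q≤b | _ , hereₗ refl , refl = s≤s z≤n , region-head⁺ m≤q q≤b ∷ [] , [] ∷ []
  ...     | m≤q , q≤b | _ , thereₗ T∈ , refl =
    let _ , region , sorted = chains-sound P (2 + q) T∈ in
    s≤s z≤n , region-head⁺ m≤q q≤b ∷ All.map (region-tail-widen m≤q) region , All.map region-tail⁻ region ∷ sorted

  chains-complete : ∀ P m M → 1 ≤ length M → Chain b P m M → M ∈ₗ chains b P m
  chains-complete zero    m (r ∷ M) _ ((() , _) ∷ _ , _)
  chains-complete (suc P) m ((p , q) ∷ M) _ (in-region@(p<1+P , q≤b , _) ∷ region , head≺ ∷ sorted)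
    with m≤n⇒m<n∨m≡n (≤-pred p<1+P)
  ... | inj₁ p<P  = ∈-++⁺ˡ (chains-complete P (suc m) _ (s≤s z≤n)
      ( region-shift⁻ p<P in-region ∷ All.zipWith (λ (r-in , (r< , _)) → region-shift⁻ (<-trans r< p<P) r-in) (region , head≺)
      , head≺ ∷ sorted))
  ... | inj₂ refl = ∈-++⁺ʳ (chains b P (suc m))
      (∈-concatMap⁺ (headed b P) (lose (∈-between⁺ m b (region-head⁻ in-region) q≤b)
                                     (∈-map⁺ ((P , q) ∷_) (tail∈ M region head≺ sorted))))
    where
    tail∈ : ∀ T → All (InRegion b (suc P) m) T → All ((P , q) ≺_) T → AllPairs _≺_ T → T ∈ₗ [] ∷ chains b P (2 + q)
    tail∈ []      _      _     _      = hereₗ refl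
    tail∈ (r ∷ T) region head≺ sorted = thereₗ (chains-complete P (2 + q) _ (s≤s z≤n)
      (All.zipWith (λ ((_ , r-q≤ , _) , r≻) → region-tail⁺ r-q≤ r≻) (region , head≺) , sorted))

  headed-head : ∀ {P q v} → v ∈ₗ headed b P q → Σ[ T ∈ Matrix2 ] v ≡ (P , q) ∷ T
  headed-head {P} {q} v∈ = let T , _ , v≡ = ∈-map⁻ ((P , q) ∷_) v∈ in T , v≡

  headed-injective : ∀ {P x y v} → v ∈ₗ headed b P x → v ∈ₗ headed b P y → x ≡ y
  headed-injective v∈x v∈y = cong proj₂ (∷-injectiveˡ (trans (sym (proj₂ (headed-head v∈x))) (proj₂ (headed-head v∈y))))

  chains-unique : ∀ P m → Unique (chains b P m)
  chains-unique zero    m = []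
  chains-unique (suc P) m =
    Unique.++⁺ (chains-unique P (suc m)) (concatMap-unique (headed b P) (interval-unique m (suc b ∸ m)) headed-unique headed-injective) disjoint
    where
    headed-unique : ∀ q → Unique (headed b P q)
    headed-unique q = ∷-map-unique (P , q)
      (All.tabulate (λ T∈ []≡T → contradiction (subst (λ T → 1 ≤ length T) (sym []≡T) (proj₁ (chains-sound P (2 + q) T∈))) λ ())
       ∷ chains-unique P (2 + q))
    disjoint : ∀ {v} → ¬ (v ∈ₗ chains b P (suc m) × v ∈ₗ concatMap (headed b P) (between m b))
    disjoint (v∈ˡ , v∈ʳ) with find (∈-concatMap⁻ (headed b P) {xs = between m b} v∈ʳ)
    ... | q , _ , v∈ with headed-head v∈
    ...   | _ , refl = <-irrefl refl (proj₁ (All.head (proj₁ (proj₂ (chains-sound P (suc m) v∈ˡ)))))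

  LongMatrix : ℕ → Matrix2 → Set
  LongMatrix P M = 2 ≤ length M × All (λ r → proj₁ r < P × proj₂ r ≤ b) M × AllPairs _≺_ M

  longMatrices : ℕ → List Matrix2
  longMatrices zero    = []
  longMatrices (suc P) = longMatrices P ++ concatMap (headedLong b P) (between 0 b)

  longMatrices-sound : ∀ P {M} → M ∈ₗ longMatrices P → LongMatrix P M
  longMatrices-sound (suc P) M∈ with ∈-++⁻ (longMatrices P) M∈
  ... | inj₁ M∈ˡ = let long , bounded , sorted = longMatrices-sound P M∈ˡ in
                   long , All.map (map₁ m<n⇒m<1+n) bounded , sorted
  ... | inj₂ M∈ʳ with find (∈-concatMap⁻ (headedLong b P) {xs = between 0 b} M∈ʳ)
  ...   | q , q∈ , M∈′ with ∈-map⁻ ((P , q) ∷_) M∈′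
  ...     | T , T∈ , refl =
    let nonempty , region , sorted = chains-sound P (2 + q) T∈ in
    s≤s nonempty , (≤-refl , proj₂ (∈-between⁻ 0 b q∈)) ∷ All.map (λ (p< , q≤ , _) → m<n⇒m<1+n p< , q≤) region
                 , All.map region-tail⁻ region ∷ sorted

  longMatrices-complete : ∀ P M → LongMatrix P M → M ∈ₗ longMatrices P
  longMatrices-complete zero    (r ∷ M) (_ , (() , _) ∷ _ , _)
  longMatrices-complete (suc P) ((p , q) ∷ T) (long , bounds@(p<1+P , q≤b) ∷ bounded , head≺ ∷ sorted)
    with m≤n⇒m<n∨m≡n (≤-pred p<1+P)
  ... | inj₁ p<P  = ∈-++⁺ˡ (longMatrices-complete P _ (long
      , (p<P , q≤b) ∷ All.zipWith (λ ((_ , r-q≤) , (r< , _)) → <-trans r< p<P , r-q≤) (bounded , head≺)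
      , head≺ ∷ sorted))
  ... | inj₂ refl = ∈-++⁺ʳ (longMatrices P)
      (∈-concatMap⁺ (headedLong b P) (lose (∈-between⁺ 0 b z≤n q≤b) (∈-map⁺ ((P , q) ∷_) (tail∈ T long bounded head≺ sorted))))
    where
    tail∈ : ∀ T → 2 ≤ suc (length T) → All (λ r → proj₁ r < suc P × proj₂ r ≤ b) T → All ((P , q) ≺_) T →
            AllPairs _≺_ T → T ∈ₗ chains b P (2 + q)
    tail∈ []      (s≤s ())
    tail∈ (r ∷ T) _ bounded head≺ sorted = chains-complete P (2 + q) _ (s≤s z≤n)
      (All.zipWith (λ ((_ , r-q≤) , r≻) → region-tail⁺ r-q≤ r≻) (bounded , head≺) , sorted)

  longMatrices-unique : ∀ P → Unique (longMatrices P)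
  longMatrices-unique zero    = []
  longMatrices-unique (suc P) =
    Unique.++⁺ (longMatrices-unique P)
      (concatMap-unique (headedLong b P) (interval-unique 0 (suc b)) (λ q → ∷-map-unique (P , q) (chains-unique P (2 + q)))
        λ v∈x v∈y → headed-injective (thereₗ v∈x) (thereₗ v∈y))
      disjoint
    where
    disjoint : ∀ {v} → ¬ (v ∈ₗ longMatrices P × v ∈ₗ concatMap (headedLong b P) (between 0 b))
    disjoint (v∈ˡ , v∈ʳ) with find (∈-concatMap⁻ (headedLong b P) {xs = between 0 b} v∈ʳ)
    ... | q , _ , v∈ with headed-head (thereₗ v∈)
    ...   | _ , refl = <-irrefl refl (proj₁ (All.head (proj₁ (proj₂ (longMatrices-sound P v∈ˡ)))))

singleRow : ℕ → ℕ → Matrix2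
singleRow p q = (p , q) ∷ []

singleRows : ℕ → ℕ → List Matrix2
singleRows a b = concatMap (λ p → map (singleRow p) (interval 0 b)) (interval 1 a)

singleRows-sound : ∀ a b {M} → M ∈ₗ singleRows a b → Σ[ p ∈ ℕ ] Σ[ q ∈ ℕ ] M ≡ singleRow p q × 0 < p × p ≤ a × q < b
singleRows-sound a b M∈ with find (∈-concatMap⁻ _ {xs = interval 1 a} M∈)
... | p , p∈ , M∈′ with ∈-map⁻ (singleRow p) M∈′
...   | q , q∈ , refl = let 0<p , p< = ∈-interval⁻ 1 a p∈ in p , q , refl , 0<p , ≤-pred p< , proj₂ (∈-interval⁻ 0 b q∈)

singleRows-complete : ∀ a b {p q} → 0 < p → p ≤ a → q < b → singleRow p q ∈ₗ singleRows a b
singleRows-complete a b {p} 0<p p≤a q<b =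
  ∈-concatMap⁺ _ (lose (∈-interval⁺ 1 a 0<p (s≤s p≤a)) (∈-map⁺ (singleRow p) (∈-interval⁺ 0 b z≤n q<b)))

singleRows-unique : ∀ a b → Unique (singleRows a b)
singleRows-unique a b = concatMap-unique _ (interval-unique 1 a)
  (λ p → Unique.map⁺ (cong proj₂ ∘ ∷-injectiveˡ) (interval-unique 0 b))
  λ v∈x v∈y → cong proj₁ (∷-injectiveˡ (trans (sym (proj₂ (proj₂ (∈-map⁻ _ v∈x)))) (proj₂ (proj₂ (∈-map⁻ _ v∈y)))))

validMatrices : ℕ → ℕ → List Matrix2
validMatrices a b = longMatrices b (suc a) ++ singleRows a b

validMatrices-sound : ∀ a b {M} → M ∈ₗ validMatrices a b → ValidMatrix a b M
validMatrices-sound a b M∈ with ∈-++⁻ (longMatrices b (suc a)) M∈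
... | inj₁ M∈ˡ = let long , bounded , sorted = longMatrices-sound b (suc a) M∈ˡ in
  ≤-trans (s≤s z≤n) long , All.map (map₁ ≤-pred) bounded
  , (λ len≡1 → contradiction (subst (2 ≤_) len≡1 long) λ { (s≤s ()) }) , λ _ → sorted
... | inj₂ M∈ʳ with singleRows-sound a b M∈ʳ
...   | p , q , refl , 0<p , p≤a , q<b = s≤s z≤n , (p≤a , <⇒≤ q<b) ∷ [] , (λ _ → (0<p , q<b) ∷ []) , λ { (s≤s ()) }

validMatrices-complete : ∀ a b M → ValidMatrix a b M → M ∈ₗ validMatrices a b
validMatrices-complete a b ((p , q) ∷ []) (_ , (p≤a , _) ∷ [] , single , _) with single refl
... | (0<p , q<b) ∷ [] = ∈-++⁺ʳ (longMatrices b (suc a)) (singleRows-complete a b 0<p p≤a q<b)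
validMatrices-complete a b (r ∷ r′ ∷ M) (_ , bounded , _ , sorted) =
  ∈-++⁺ˡ (longMatrices-complete b (suc a) _ (s≤s (s≤s z≤n) , All.map (map₁ s≤s) bounded , sorted (s≤s (s≤s z≤n))))

validMatrices-unique : ∀ a b → Unique (validMatrices a b)
validMatrices-unique a b = Unique.++⁺ (longMatrices-unique b (suc a)) (singleRows-unique a b) λ (M∈ˡ , M∈ʳ) →
  let _ , _ , M≡ , _ = singleRows-sound a b M∈ʳ in
  contradiction (subst (λ M → 2 ≤ length M) M≡ (proj₁ (longMatrices-sound b (suc a) M∈ˡ))) λ { (s≤s ()) }

-- Counting the valid matrices

sum0to : (ℕ → ℕ) → ℕ → ℕ
sum0to f zero    = f 0
sum0to f (suc n) = sum0to f n + f (suc n)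

mutual
  -- chainCount P w = 1 + length (chains b P m) when m + w = 2 + b (length-chains)
  chainCount : ℕ → ℕ → ℕ
  chainCount zero    w       = 1
  chainCount (suc P) zero    = 1
  chainCount (suc P) (suc w) = chainCountSum P (suc w)

  chainCountSum : ℕ → ℕ → ℕ
  chainCountSum P zero    = 0
  chainCountSum P (suc k) = chainCount P k + chainCountSum P k

module _ (b : ℕ) where

  chains-empty : ∀ P m → b < m → chains b P m ≡ []
  chains-empty zero    m b<m = refl
  chains-empty (suc P) m b<m rewrite m≤n⇒m∸n≡0 b<m = trans (++-identityʳ _) (chains-empty P (suc m) (m<n⇒m<1+n b<m))

  sum-interval-chainCount : ∀ P (g : ℕ → ℕ) → (∀ q j → q + j ≡ b → g q ≡ chainCount P j) →
                            ∀ k m → m + k ≡ suc b → sum (map g (interval m k)) ≡ chainCountSum P k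
  sum-interval-chainCount P g g≡ zero    m _   = refl
  sum-interval-chainCount P g g≡ (suc k) m m+k =
    cong₂ _+_ (g≡ m k (suc-injective m+k′)) (sum-interval-chainCount P g g≡ k (suc m) m+k′)
    where
    m+k′ : suc m + k ≡ suc b
    m+k′ = trans (sym (+-suc m k)) m+k

  mutual
    length-chains : ∀ P m w → m + w ≡ 2 + b → suc (length (chains b P m)) ≡ chainCount P w
    length-chains zero    m w       _   = refl
    length-chains (suc P) m zero    m≡ =
      cong suc (cong length (chains-empty (suc P) m (≤-trans (n≤1+n _) (≤-reflexive (sym (trans (sym (+-identityʳ m)) m≡))))))
    length-chains (suc P) m (suc w) m+w = begin
      suc (length (chains b (suc P) m))
        ≡⟨ cong suc (length-++ (chains b P (suc m))) ⟩
      suc (length (chains b P (suc m))) + length (concatMap (headed b P) (between m b))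
        ≡⟨ cong₂ _+_ (length-chains P (suc m) w (trans (sym (+-suc m w)) m+w)) (length-concatMap (headed b P) (between m b)) ⟩
      chainCount P w + sum (map (length ∘ headed b P) (interval m (suc b ∸ m)))
        ≡⟨ cong (λ k → chainCount P w + sum (map (length ∘ headed b P) (interval m k))) 1+b∸m≡w ⟩
      chainCount P w + sum (map (length ∘ headed b P) (interval m w))
        ≡⟨ cong (chainCount P w +_) (sum-interval-chainCount P _ (length-headed≡chainCount P) w m m+w′) ⟩
      chainCount P w + chainCountSum P w
        ∎
      where
      open ≡-Reasoning
      m+w′ : m + w ≡ suc b
      m+w′ = suc-injective (trans (sym (+-suc m w)) m+w)
      1+b∸m≡w : suc b ∸ m ≡ w
      1+b∸m≡w = trans (cong (_∸ m) (sym m+w′)) (m+n∸m≡n m w)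

    length-headed≡chainCount : ∀ P q j → q + j ≡ b → length (headed b P q) ≡ chainCount P j
    length-headed≡chainCount P q j q+j = trans (cong suc (length-map ((P , q) ∷_) (chains b P (2 + q))))
                                               (length-chains P (2 + q) j (cong (2 +_) q+j))

  length-headed : ∀ P qs → length (concatMap (headed b P) qs) ≡ length (concatMap (headedLong b P) qs) + length qs
  length-headed P []       = refl
  length-headed P (q ∷ qs) = begin
    suc (length (headedLong b P q ++ concatMap (headed b P) qs))  ≡⟨ cong suc (length-++ (headedLong b P q)) ⟩
    suc (L + length (concatMap (headed b P) qs))                  ≡⟨ cong (λ n → suc (L + n)) (length-headed P qs) ⟩
    suc (L + (R + length qs))                                     ≡⟨ cong suc (+-assoc L R (length qs)) ⟨
    suc (L + R + length qs)                                       ≡⟨ +-suc (L + R) (length qs) ⟨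
    L + R + suc (length qs)                                       ≡⟨ cong (_+ suc (length qs)) (length-++ (headedLong b P q)) ⟨
    length (headedLong b P q ++ concatMap (headedLong b P) qs) + suc (length qs) ∎
    where
    open ≡-Reasoning
    L = length (headedLong b P q)
    R = length (concatMap (headedLong b P) qs)

  length-longMatrices : ∀ P → length (longMatrices b P) + P * suc b + 1 ≡ sum0to (λ k → chainCount k (suc b)) P
  length-longMatrices zero    = refl
  length-longMatrices (suc P) = begin
    length (longMatrices b P ++ concatMap (headedLong b P) (between 0 b)) + suc P * suc b + 1
      ≡⟨ cong (λ n → n + suc P * suc b + 1) (length-++ (longMatrices b P)) ⟩
    T + S + suc P * suc b + 1
      ≡⟨ rearrange T S P b ⟩
    (T + P * suc b + 1) + (S + suc b)
      ≡⟨ cong₂ _+_ (length-longMatrices P) headed-count ⟩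
    sum0to (λ k → chainCount k (suc b)) P + chainCount (suc P) (suc b) ∎
    where
    open ≡-Reasoning
    T = length (longMatrices b P)
    S = length (concatMap (headedLong b P) (between 0 b))
    rearrange : ∀ T S P b → T + S + suc P * suc b + 1 ≡ (T + P * suc b + 1) + (S + suc b)
    rearrange = solve-∀
    headed-count : S + suc b ≡ chainCount (suc P) (suc b)
    headed-count = begin
      S + suc b                                               ≡⟨ cong (S +_) (length-interval 0 (suc b)) ⟨
      S + length (between 0 b)                                ≡⟨ length-headed P (between 0 b) ⟨
      length (concatMap (headed b P) (between 0 b))           ≡⟨ length-concatMap (headed b P) (between 0 b) ⟩
      sum (map (length ∘ headed b P) (interval 0 (suc b)))    ≡⟨ sum-interval-chainCount P _ (length-headed≡chainCount P) (suc b) 0 refl ⟩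
      chainCountSum P (suc b)                                 ∎

length-singleRows : ∀ a b → length (singleRows a b) ≡ a * b
length-singleRows a b = begin
  length (singleRows a b)                                             ≡⟨ length-concatMap _ (interval 1 a) ⟩
  sum (map (λ p → length (map (singleRow p) (interval 0 b))) (interval 1 a)) ≡⟨ sum-const 1 a ⟩
  a * b                                                               ∎
  where
  open ≡-Reasoning
  sum-const : ∀ m k → sum (map (λ p → length (map (singleRow p) (interval 0 b))) (interval m k)) ≡ k * b
  sum-const m zero    = refl
  sum-const m (suc k) = cong₂ _+_ (trans (length-map _ (interval 0 b)) (length-interval 0 b)) (sum-const (suc m) k)

-- all chains, the empty one included, with entries at most a and b
allChains : ℕ → ℕ → ℕ
allChains a b = sum0to (λ k → chainCount k (suc b)) (suc a)

length-validMatrices : ∀ a b → length (validMatrices a b) + (a + b + 2) ≡ allChains a b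
length-validMatrices a b = begin
  length (longMatrices b (suc a) ++ singleRows a b) + (a + b + 2)
    ≡⟨ cong (_+ (a + b + 2)) (trans (length-++ (longMatrices b (suc a))) (cong (L +_) (length-singleRows a b))) ⟩
  L + a * b + (a + b + 2)  ≡⟨ rearrange L a b ⟩
  L + suc a * suc b + 1    ≡⟨ length-longMatrices b (suc a) ⟩
  allChains a b            ∎
  where
  open ≡-Reasoning
  L = length (longMatrices b (suc a))
  rearrange : ∀ L a b → L + a * b + (a + b + 2) ≡ L + suc a * suc b + 1
  rearrange = solve-∀

chainCount-0 : ∀ P → chainCount P 0 ≡ 1
chainCount-0 zero    = refl
chainCount-0 (suc P) = refl

chainCount-1 : ∀ P → chainCount P 1 ≡ 1
chainCount-1 zero    = refl
chainCount-1 (suc P) = cong (_+ 0) (chainCount-0 P)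

chainCountSum-0 : ∀ k → chainCountSum 0 k ≡ k
chainCountSum-0 zero    = refl
chainCountSum-0 (suc k) = cong suc (chainCountSum-0 k)

sum0to-cong : ∀ {f g : ℕ → ℕ} n → (∀ k → f k ≡ g k) → sum0to f n ≡ sum0to g n
sum0to-cong zero    f≡g = f≡g 0
sum0to-cong (suc n) f≡g = cong₂ _+_ (sum0to-cong n f≡g) (f≡g (suc n))

sum0to-+ : ∀ (f g : ℕ → ℕ) n → sum0to (λ k → f k + g k) n ≡ sum0to f n + sum0to g n
sum0to-+ f g zero    = refl
sum0to-+ f g (suc n) = trans (cong (_+ (f (suc n) + g (suc n))) (sum0to-+ f g n))
                             (rearrange (sum0to f n) (sum0to g n) (f (suc n)) (g (suc n)))
  where
  rearrange : ∀ a b c d → a + b + (c + d) ≡ a + c + (b + d)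
  rearrange = solve-∀

sum0to-suc : ∀ (f : ℕ → ℕ) n → sum0to f (suc n) ≡ f 0 + sum0to (f ∘ suc) n
sum0to-suc f zero    = refl
sum0to-suc f (suc n) = trans (cong (_+ f (suc (suc n))) (sum0to-suc f n)) (+-assoc (f 0) _ _)

sum0to-1 : ∀ n → sum0to (λ _ → 1) n ≡ suc n
sum0to-1 zero    = refl
sum0to-1 (suc n) = trans (cong (_+ 1) (sum0to-1 n)) (+-comm (suc n) 1)

allChains-b0 : ∀ a → allChains a 0 ≡ a + 2
allChains-b0 a = trans (sum0to-cong (suc a) chainCount-1) (trans (sum0to-1 (suc a)) (+-comm 2 a))

allChains-a0 : ∀ b → allChains 0 b ≡ b + 2
allChains-a0 b = trans (cong (2 +_) (chainCountSum-0 b)) (+-comm 2 b)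

allChains-suc : ∀ a b → allChains (suc a) (suc b) ≡ allChains (suc a) b + allChains a b
allChains-suc a b = begin
  allChains (suc a) (suc b)
    ≡⟨ sum0to-suc (λ k → chainCount k (suc (suc b))) (suc a) ⟩
  1 + sum0to (λ k → chainCount k (suc b) + chainCount (suc k) (suc b)) (suc a)
    ≡⟨ cong (1 +_) (sum0to-+ (λ k → chainCount k (suc b)) (λ k → chainCount (suc k) (suc b)) (suc a)) ⟩
  1 + (allChains a b + sum0to (λ k → chainCount (suc k) (suc b)) (suc a))
    ≡⟨ cong suc (+-comm (allChains a b) _) ⟩
  1 + sum0to (λ k → chainCount (suc k) (suc b)) (suc a) + allChains a b
    ≡⟨ cong (_+ allChains a b) (sum0to-suc (λ k → chainCount k (suc b)) (suc a)) ⟨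
  allChains (suc a) b + allChains a b
    ∎
  where open ≡-Reasoning

skewSum : ℕ → ℕ → ℕ
skewSum zero    b = 0
skewSum (suc j) b = allChains (suc j) b + skewSum j (suc b)

skewSum-suc : ∀ k b → skewSum (suc k) (suc b) ≡ skewSum (suc k) b + allChains 0 (b + k) + skewSum k b
skewSum-suc zero b = begin
  allChains 1 (suc b) + 0                 ≡⟨ cong (_+ 0) (allChains-suc 0 b) ⟩
  allChains 1 b + allChains 0 b + 0       ≡⟨ rearrange (allChains 1 b) (allChains 0 b) ⟩
  allChains 1 b + 0 + allChains 0 b + 0   ≡⟨ cong (λ z → allChains 1 b + 0 + allChains 0 z + 0) (+-identityʳ b) ⟨
  allChains 1 b + 0 + allChains 0 (b + 0) + 0 ∎
  where
  open ≡-Reasoning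
  rearrange : ∀ x y → x + y + 0 ≡ x + 0 + y + 0
  rearrange = solve-∀
skewSum-suc (suc k) b = begin
  allChains (2 + k) (suc b) + skewSum (suc k) (2 + b)
    ≡⟨ cong₂ _+_ (allChains-suc (suc k) b) (skewSum-suc k (suc b)) ⟩
  allChains (2 + k) b + allChains (suc k) b + (skewSum (suc k) (suc b) + allChains 0 (suc b + k) + skewSum k (suc b))
    ≡⟨ cong (λ z → allChains (2 + k) b + allChains (suc k) b + (skewSum (suc k) (suc b) + allChains 0 z + skewSum k (suc b))) (+-suc b k) ⟨
  allChains (2 + k) b + allChains (suc k) b + (skewSum (suc k) (suc b) + allChains 0 (b + suc k) + skewSum k (suc b))
    ≡⟨ rearrange (allChains (2 + k) b) (allChains (suc k) b) (skewSum (suc k) (suc b)) (allChains 0 (b + suc k)) (skewSum k (suc b)) ⟩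
  allChains (2 + k) b + skewSum (suc k) (suc b) + allChains 0 (b + suc k) + (allChains (suc k) b + skewSum k (suc b)) ∎
  where
  open ≡-Reasoning
  rearrange : ∀ x y z u v → x + y + (z + u + v) ≡ x + z + u + (y + v)
  rearrange = solve-∀

diagonal : ℕ → ℕ
diagonal n = skewSum n 0

diagonal-suc : ∀ n → diagonal (2 + n) ≡ diagonal (1 + n) + diagonal n + (2 * n + 6)
diagonal-suc n = begin
  allChains (2 + n) 0 + skewSum (1 + n) 1
    ≡⟨ cong₂ _+_ (allChains-b0 (2 + n)) (skewSum-suc n 0) ⟩
  (2 + n + 2) + (diagonal (1 + n) + allChains 0 n + diagonal n)
    ≡⟨ cong (λ z → (2 + n + 2) + (diagonal (1 + n) + z + diagonal n)) (allChains-a0 n) ⟩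
  (2 + n + 2) + (diagonal (1 + n) + (n + 2) + diagonal n)
    ≡⟨ rearrange n (diagonal (1 + n)) (diagonal n) ⟩
  diagonal (1 + n) + diagonal n + (2 * n + 6) ∎
  where
  open ≡-Reasoning
  rearrange : ∀ n x y → (2 + n + 2) + (x + (n + 2) + y) ≡ x + y + (2 * n + 6)
  rearrange = solve-∀

diagonal-fib : ∀ n → diagonal n + (2 * n + 8) ≡ F (6 + n)
diagonal-fib zero          = refl
diagonal-fib (suc zero)    = refl
diagonal-fib (suc (suc n)) = begin
  diagonal (2 + n) + (2 * (2 + n) + 8)
    ≡⟨ cong (_+ (2 * (2 + n) + 8)) (diagonal-suc n) ⟩
  diagonal (1 + n) + diagonal n + (2 * n + 6) + (2 * (2 + n) + 8)
    ≡⟨ rearrange n (diagonal (1 + n)) (diagonal n) ⟩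
  (diagonal (1 + n) + (2 * (1 + n) + 8)) + (diagonal n + (2 * n + 8))
    ≡⟨ cong₂ _+_ (diagonal-fib (suc n)) (diagonal-fib n) ⟩
  F (6 + suc n) + F (6 + n) ∎
  where
  open ≡-Reasoning
  rearrange : ∀ n x y → x + y + (2 * n + 6) + (2 * (2 + n) + 8) ≡ (x + (2 * (1 + n) + 8)) + (y + (2 * n + 8))
  rearrange = solve-∀

sum1to-cong : ∀ {f g : ℕ → ℕ} k → (∀ a → f a ≡ g a) → sum1to f k ≡ sum1to g k
sum1to-cong zero    f≡g = refl
sum1to-cong (suc k) f≡g = cong₂ _+_ (sum1to-cong k f≡g) (f≡g (suc k))

skewSum≡sum1to : ∀ j b → skewSum j b ≡ sum1to (λ a → allChains a (b + j ∸ a)) j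
skewSum≡sum1to zero    b = refl
skewSum≡sum1to (suc j) b = begin
  allChains (suc j) b + skewSum j (suc b)
    ≡⟨ cong (allChains (suc j) b +_) (skewSum≡sum1to j (suc b)) ⟩
  allChains (suc j) b + sum1to (λ a → allChains a (suc b + j ∸ a)) j
    ≡⟨ cong (allChains (suc j) b +_) (sum1to-cong j (λ a → cong (λ z → allChains a (z ∸ a)) (sym (+-suc b j)))) ⟩
  allChains (suc j) b + sum1to (λ a → allChains a (b + suc j ∸ a)) j
    ≡⟨ +-comm (allChains (suc j) b) _ ⟩
  sum1to (λ a → allChains a (b + suc j ∸ a)) j + allChains (suc j) b
    ≡⟨ cong (λ z → sum1to (λ a → allChains a (b + suc j ∸ a)) j + allChains (suc j) z) (m+n∸n≡m b (suc j)) ⟨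
  sum1to (λ a → allChains a (b + suc j ∸ a)) (suc j) ∎
  where open ≡-Reasoning

sum1to-+const : ∀ (f g : ℕ → ℕ) c k → (∀ a → 1 ≤ a → a ≤ k → f a + c ≡ g a) → sum1to f k + k * c ≡ sum1to g k
sum1to-+const f g c zero    _   = refl
sum1to-+const f g c (suc k) f+c = begin
  sum1to f k + f (suc k) + (c + k * c)    ≡⟨ rearrange (sum1to f k) (f (suc k)) c (k * c) ⟩
  (sum1to f k + k * c) + (f (suc k) + c)  ≡⟨ cong₂ _+_ (sum1to-+const f g c k (λ a 1≤a a≤k → f+c a 1≤a (m≤n⇒m≤1+n a≤k)))
                                                        (f+c (suc k) (s≤s z≤n) ≤-refl) ⟩
  sum1to g k + g (suc k)                  ∎
  where
  open ≡-Reasoning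
  rearrange : ∀ x y z w → x + y + (z + w) ≡ (x + w) + (y + z)
  rearrange = solve-∀

matrixCount : ℕ → ℕ → ℕ
matrixCount a b = length (validMatrices a b)

matrixCount-fib : ∀ n → sum1to (λ a → matrixCount a (n ∸ a)) n + (n * n + 4 * n + 8) ≡ F (n + 6)
matrixCount-fib n = begin
  H + (n * n + 4 * n + 8)                                ≡⟨ rearrange H n ⟩
  (H + n * (n + 2)) + (2 * n + 8)                        ≡⟨ cong (_+ (2 * n + 8)) (sum1to-+const _ _ (n + 2) n per-size) ⟩
  sum1to (λ a → allChains a (n ∸ a)) n + (2 * n + 8)     ≡⟨ cong (_+ (2 * n + 8)) (skewSum≡sum1to n 0) ⟨
  diagonal n + (2 * n + 8)                               ≡⟨ diagonal-fib n ⟩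
  F (6 + n)                                              ≡⟨ cong F (+-comm 6 n) ⟩
  F (n + 6)                                              ∎
  where
  open ≡-Reasoning
  H = sum1to (λ a → matrixCount a (n ∸ a)) n
  rearrange : ∀ H n → H + (n * n + 4 * n + 8) ≡ (H + n * (n + 2)) + (2 * n + 8)
  rearrange = solve-∀
  per-size : ∀ a → 1 ≤ a → a ≤ n → matrixCount a (n ∸ a) + (n + 2) ≡ allChains a (n ∸ a)
  per-size a _ a≤n = trans (cong (λ m → matrixCount a (n ∸ a) + (m + 2)) (sym (m+[n∸m]≡n a≤n))) (length-validMatrices a (n ∸ a))

module CanonicalGames (n : ℕ) where

  Code : Set
  Code = ℕ × Matrix2

  code : ℕ → Matrix2 → Code
  code a M = a , M

  GoodCode : Code → Set
  GoodCode (a , M) = 1 ≤ a × a ≤ n × ValidMatrix a (n ∸ a) M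

  game : Code → Family n
  game (a , M) = canonicalGame n a M

  codes : ℕ → List Code
  codes zero    = []
  codes (suc k) = codes k ++ map (code (suc k)) (validMatrices (suc k) (n ∸ suc k))

  length-codes : ∀ k → length (codes k) ≡ sum1to (λ a → matrixCount a (n ∸ a)) k
  length-codes zero    = refl
  length-codes (suc k) =
    trans (length-++ (codes k)) (cong₂ _+_ (length-codes k) (length-map (code (suc k)) (validMatrices (suc k) (n ∸ suc k))))

  codes-good : ∀ k → k ≤ n → All GoodCode (codes k)
  codes-good zero    _   = []
  codes-good (suc k) k<n = All.++⁺ (codes-good k (<⇒≤ k<n))
    (All.map⁺ (All.tabulate λ M∈ → s≤s z≤n , k<n , validMatrices-sound (suc k) (n ∸ suc k) M∈))

  codes-bounded : ∀ k → All (λ c → proj₁ c ≤ k) (codes k)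
  codes-bounded zero    = []
  codes-bounded (suc k) = All.++⁺ (All.map m≤n⇒m≤1+n (codes-bounded k)) (All.map⁺ (All.tabulate λ _ → ≤-refl))

  codes-unique : ∀ k → Unique (codes k)
  codes-unique zero    = []
  codes-unique (suc k) = Unique.++⁺ (codes-unique k) (Unique.map⁺ ,-injectiveʳ (validMatrices-unique (suc k) (n ∸ suc k)))
    λ (c∈ˡ , c∈ʳ) → let _ , _ , c≡ = ∈-map⁻ (code (suc k)) c∈ʳ in
                    <-irrefl refl (s≤s (subst (λ c → proj₁ c ≤ k) c≡ (All.lookup (codes-bounded k) c∈ˡ)))

  codes-complete : ∀ k {a M} → 1 ≤ a → a ≤ k → ValidMatrix a (n ∸ a) M → (a , M) ∈ₗ codes k
  codes-complete zero    (s≤s _) ()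
  codes-complete (suc k) {a} {M} 1≤a a≤1+k valid with m≤n⇒m<n∨m≡n a≤1+k
  ... | inj₁ a<1+k = ∈-++⁺ˡ (codes-complete k 1≤a (≤-pred a<1+k) valid)
  ... | inj₂ refl  = ∈-++⁺ʳ (codes k) (∈-map⁺ (code (suc k)) (validMatrices-complete (suc k) (n ∸ suc k) M valid))

  games : List (Family n)
  games = map game (codes n)

  nonIsomorphic : ∀ {cs} → Unique cs → All GoodCode cs → AllPairs (λ c c′ → ¬ Isomorphic (game c) (game c′)) cs
  nonIsomorphic []         []                          = []
  nonIsomorphic (c∉ ∷ cs!) ((_ , a≤n , valid) ∷ good) =
    All.zipWith (λ (c≢c′ , (_ , a′≤n , valid′)) I → c≢c′ (canonical-unique a≤n a′≤n valid valid′ I)) (c∉ , good)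
    ∷ nonIsomorphic cs! good

  numTwoClassGames : NumTwoClassGamesUpToIso n (sum1to (λ a → matrixCount a (n ∸ a)) n)
  numTwoClassGames =
    games , trans (length-map game (codes n)) (length-codes n)
    , All.map⁺ (All.map (λ (_ , a≤n , valid) → TwoClassTable.isCompleteTwoClassGame (canonical-isTwoClassTable a≤n valid))
                        (codes-good n ≤-refl))
    , AllPairs.map⁺ (nonIsomorphic (codes-unique n) (codes-good n ≤-refl))
    , λ W W-game → let a , M , 1≤a , a≤n , valid , I = classify W-game in
                   lose (∈-map⁺ game (codes-complete n 1≤a a≤n valid)) I

numMatrices : ∀ a b → NumMatrices a b (matrixCount a b)
numMatrices a b = validMatrices a b , refl , validMatrices-unique a b , All.tabulate (validMatrices-sound a b) , validMatrices-complete a b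

lemma3 : ∀ (n : ℕ) → 1 ≤ n →
    Σ[ H ∈ ℕ ] Σ[ G ∈ (ℕ → ℕ → ℕ) ]
        NumTwoClassGamesUpToIso n H
      × (∀ a → 1 ≤ a → a ≤ n → NumMatrices a (n ∸ a) (G a (n ∸ a)))
      × H ≡ sum1to (λ a → G a (n ∸ a)) n
      × H + (n * n + 4 * n + 8) ≡ F (n + 6)
lemma3 n _ = sum1to (λ a → matrixCount a (n ∸ a)) n , matrixCount
           , CanonicalGames.numTwoClassGames n
           , (λ a _ _ → numMatrices a (n ∸ a))
           , refl
           , matrixCount-fib n
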